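{- Let $n\ge 3$ and let $\phi\colon E(K_n)\to\{\text{red},\text{blue}\}$ be a non-monochromatic coloring. Then: (1) if $\phi$ is special, then $w(\phi)=3\cdot 2^{n-1}+1$; (2) if $\phi$ is non-special, then $w(\phi)<3\cdot 2^{n-1}$.
   Context: A Gallai coloring of $K_m$ is a coloring $E(K_m)\to\{\text{red},\text{green},\text{blue}\}$ with no rainbow triangle (triangle whose three edges have three distinct colors). For a Gallai coloring $\psi$ of $K_m$, regard $K_{m+1}$ as $K_m$ plus a new vertex $u$; $w(\psi)$ is the number of colorings of the edges from $u$ to $V(K_m)$ with colors in $\{\text{red},\text{green},\text{blue}\}$ such that the resulting coloring of $E(K_{m+1})$ is Gallai. A vertex is monochromatic (of color $c$) if all its incident edges have color $c$. A coloring of $E(K_n)$ using exactly two colors is vertex-special if there is a vertex $v$ monochromatic in a color $c_1$ and all edges not incident to $v$ have a single color $c_2\neq c_1$; it is edge-special if all edges have the same color except for exactly one edge; it is special if it is vertex-special or edge-special, and non-special otherwise. -}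

module Defs where

open import Data.Nat using (ℕ; zero; suc)
open import Data.Fin using (Fin; zero; suc)
open import Data.Fin.Properties using (all?) renaming (_≟_ to _≟ᶠ_)
open import Data.List using (List; []; _∷_; map; concatMap; filter; length)
open import Data.Product using (_×_; Σ; ∃; _,_)
open import Data.Sum using (_⊎_)
open import Relation.Nullary using (¬_; Dec; yes; no)
open import Relation.Nullary.Decidable using (_×-dec_; _→-dec_; ¬?)
open import Relation.Binary.PropositionalEquality using (_≡_; _≢_; refl)
import Data.Vec.Functional as VF

data Color : Set where
  red green blue : Color

_≟c_ : (a b : Color) → Dec (a ≡ b)
red   ≟c red   = yes refl
red   ≟c green = no (λ ())
red   ≟c blue  = no (λ ())
green ≟c red   = no (λ ())
green ≟c green = yes refl
green ≟c blue  = no (λ ())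
blue  ≟c red   = no (λ ())
blue  ≟c green = no (λ ())
blue  ≟c blue  = yes refl

-- An edge colouring of K_m is represented by a function on ordered pairs of
-- vertices; only its values at pairs i ≢ j matter, and it is required to be
-- symmetric (so that it is a colouring of unordered edges).
EdgeColoring : ℕ → Set
EdgeColoring m = Fin m → Fin m → Color

Symmetric : ∀ {m} → EdgeColoring m → Set
Symmetric {m} c = ∀ (i j : Fin m) → i ≢ j → c i j ≡ c j i

Rainbow : ∀ {m} → EdgeColoring m → Fin m → Fin m → Fin m → Set
Rainbow c i j k = (c i j ≢ c j k) × (c j k ≢ c i k) × (c i j ≢ c i k)

Gallai : ∀ {m} → EdgeColoring m → Set
Gallai {m} c = ∀ (i j k : Fin m) → i ≢ j → j ≢ k → i ≢ k → ¬ Rainbow c i j k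

rainbow? : ∀ {m} (c : EdgeColoring m) i j k → Dec (Rainbow c i j k)
rainbow? c i j k =
  ¬? (c i j ≟c c j k) ×-dec (¬? (c j k ≟c c i k) ×-dec ¬? (c i j ≟c c i k))

gallai? : ∀ {m} (c : EdgeColoring m) → Dec (Gallai c)
gallai? c = all? λ i → all? λ j → all? λ k →
  ¬? (i ≟ᶠ j) →-dec (¬? (j ≟ᶠ k) →-dec (¬? (i ≟ᶠ k) →-dec ¬? (rainbow? c i j k)))

-- Extension of a colouring of K_m to K_{m+1}: the new vertex u is `zero`,
-- old vertex i of K_m becomes `suc i`; f gives the colours of the edges u–i.
-- (The value on the diagonal pair (u,u) is irrelevant.)
extend : ∀ {m} → EdgeColoring m → (Fin m → Color) → EdgeColoring (suc m)
extend ψ f zero    zero    = red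
extend ψ f zero    (suc j) = f j
extend ψ f (suc i) zero    = f i
extend ψ f (suc i) (suc j) = ψ i j

allColorFuns : (m : ℕ) → List (Fin m → Color)
allColorFuns zero    = (λ ()) ∷ []
allColorFuns (suc m) =
  concatMap (λ f → map (λ x → x VF.∷ f) (red ∷ green ∷ blue ∷ [])) (allColorFuns m)

w : ∀ {m} → EdgeColoring m → ℕ
w {m} ψ = length (filter (λ f → gallai? (extend ψ f)) (allColorFuns m))

RedBlue : ∀ {n} → EdgeColoring n → Set
RedBlue {n} φ = ∀ (i j : Fin n) → i ≢ j → (φ i j ≡ red) ⊎ (φ i j ≡ blue)

NonMonochromatic : ∀ {n} → EdgeColoring n → Set
NonMonochromatic {n} φ =
  Σ (Fin n) λ a → Σ (Fin n) λ b → Σ (Fin n) λ c → Σ (Fin n) λ d →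
    (a ≢ b) × (c ≢ d) × (φ a b ≢ φ c d)

UsesExactlyTwoColors : ∀ {n} → EdgeColoring n → Set
UsesExactlyTwoColors {n} φ =
  Σ Color λ c₁ → Σ Color λ c₂ → (c₁ ≢ c₂) ×
    (∃ λ (a : Fin n) → ∃ λ b → (a ≢ b) × (φ a b ≡ c₁)) ×
    (∃ λ (a : Fin n) → ∃ λ b → (a ≢ b) × (φ a b ≡ c₂)) ×
    (∀ (i j : Fin n) → i ≢ j → (φ i j ≡ c₁) ⊎ (φ i j ≡ c₂))

VertexSpecial : ∀ {n} → EdgeColoring n → Set
VertexSpecial {n} φ = UsesExactlyTwoColors φ ×
  (Σ (Fin n) λ v → Σ Color λ c₁ → Σ Color λ c₂ → (c₁ ≢ c₂) ×
     (∀ (j : Fin n) → v ≢ j → φ v j ≡ c₁) ×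
     (∀ (i j : Fin n) → i ≢ j → i ≢ v → j ≢ v → φ i j ≡ c₂))

EdgeSpecial : ∀ {n} → EdgeColoring n → Set
EdgeSpecial {n} φ = UsesExactlyTwoColors φ ×
  (Σ (Fin n) λ a → Σ (Fin n) λ b → Σ Color λ c → (a ≢ b) × (φ a b ≢ c) ×
     (∀ (i j : Fin n) → i ≢ j → ¬ ((i ≡ a × j ≡ b) ⊎ (i ≡ b × j ≡ a)) → φ i j ≡ c))

Special : ∀ {n} → EdgeColoring n → Set
Special φ = VertexSpecial φ ⊎ EdgeSpecial φ

-- A colour vector f on the edges at the new vertex is good exactly when no triangle through
-- the new vertex is rainbow (the old edges use only red and blue), so w φ is a sum of
-- indicators over colour vectors. Splitting off vertex 0 gives w φ ≤ 2 w φ′ + 1, which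
-- propagates the bound w < 3·2^(n-1) from a restriction φ′ that is neither special nor
-- monochromatic. Otherwise, after relabelling, φ is a monochromatic clique K_m with two
-- apexes. There the good vectors on K_m are those avoiding green or avoiding the opposite
-- colour, and inclusion–exclusion gives w in closed form as a polynomial in 2^p, 2^q, 2^t,
-- 2^u, 0^q, 0^t, 0^u, where p, q, t, u count the clique vertices by the colours of their two
-- apex edges. The closed form is below 3·2^(n-1) except for the counts of the monochromatic
-- and special colourings, and for the latter it equals 3·2^(n-1) + 1.
module Submission where

open import Defs
open import Data.Nat
open import Data.Nat.Properties hiding (suc-injective)
open import Data.Nat.Tactic.RingSolver using (solve-∀)
open import Data.Bool using (Bool; true; false; _∧_; _∨_; not)
open import Data.Bool.Properties using (∧-zeroʳ; ∧-identityʳ; ∨-comm; ∨-identityʳ; ∧-abs-∨)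
open import Data.Fin using (Fin; zero; suc)
open import Data.Fin.Properties using (suc-injective) renaming (_≟_ to _≟f_)
open import Data.Vec.Functional using (_∷_)
import Data.List as L
open import Data.List using (List; map; filter; length; concatMap; _++_)
open import Data.Nat.ListAction using (sum)
open import Data.Nat.ListAction.Properties using (sum-++)
open import Data.List.Properties using (map-++; map-cong)
open import Data.Product using (_×_; _,_; proj₁; proj₂; Σ)
open import Data.Sum using (_⊎_; inj₁; inj₂)
import Data.Sum
open import Data.Empty using (⊥; ⊥-elim)
open import Relation.Nullary using (does; Dec; yes; no; ¬_)
open import Relation.Nullary.Decidable using (dec-true; dec-false; _×-dec_; _⊎-dec_; decidable-stable; ¬¬-excluded-middle)
open import Relation.Binary.PropositionalEquality
open import Function using (_∘_; id)


-- Sums over colour vectors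

𝟙 : Bool → ℕ
𝟙 true  = 1
𝟙 false = 0

sumColor : (Color → ℕ) → ℕ
sumColor k = k red + k green + k blue

-- Read off allColorFuns 0, so that ∑ 0 agrees definitionally with the sum over that list.
emptyColoring : Fin 0 → Color
emptyColoring with allColorFuns zero
... | f L.∷ _ = f
... | L.[]    = λ ()

∑ : ∀ n → ((Fin n → Color) → ℕ) → ℕ
∑ zero    h = h emptyColoring
∑ (suc n) h = ∑ n (λ f → sumColor (λ x → h (x ∷ f)))

∏ : ∀ {n} → (Fin n → ℕ) → ℕ
∏ {zero}  F = 1
∏ {suc n} F = F zero * ∏ (λ j → F (suc j))

sumColor-cong : ∀ {k k′ : Color → ℕ} → (∀ x → k x ≡ k′ x) → sumColor k ≡ sumColor k′
sumColor-cong e = cong₂ _+_ (cong₂ _+_ (e red) (e green)) (e blue)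

sumColor-+ : ∀ (k k′ : Color → ℕ) → sumColor (λ x → k x + k′ x) ≡ sumColor k + sumColor k′
sumColor-+ k k′ = lemma (k red) (k′ red) (k green) (k′ green) (k blue) (k′ blue)
  where
  lemma : ∀ a a′ b b′ c c′ → (a + a′) + (b + b′) + (c + c′) ≡ (a + b + c) + (a′ + b′ + c′)
  lemma = solve-∀

sumColor-*ʳ : ∀ (k : Color → ℕ) a → sumColor (λ x → k x * a) ≡ sumColor k * a
sumColor-*ʳ k a = sym (trans (*-distribʳ-+ a (k red + k green) (k blue))
  (cong (_+ k blue * a) (*-distribʳ-+ a (k red) (k green))))

∑-cong : ∀ n {h h′ : (Fin n → Color) → ℕ} → (∀ f → h f ≡ h′ f) → ∑ n h ≡ ∑ n h′
∑-cong zero    eq = eq _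
∑-cong (suc n) eq = ∑-cong n (λ f → sumColor-cong (λ x → eq (x ∷ f)))

∑-mono-≤ : ∀ n {h h′ : (Fin n → Color) → ℕ} → (∀ f → h f ≤ h′ f) → ∑ n h ≤ ∑ n h′
∑-mono-≤ zero    le = le _
∑-mono-≤ (suc n) le = ∑-mono-≤ n (λ f → +-mono-≤ (+-mono-≤ (le _) (le _)) (le _))

∑-+ : ∀ n (h h′ : (Fin n → Color) → ℕ) → ∑ n (λ f → h f + h′ f) ≡ ∑ n h + ∑ n h′
∑-+ zero    h h′ = refl
∑-+ (suc n) h h′ = trans (∑-cong n (λ f → sumColor-+ (λ x → h (x ∷ f)) (λ x → h′ (x ∷ f)))) (∑-+ n _ _)

∑-* : ∀ n a (h : (Fin n → Color) → ℕ) → ∑ n (λ f → a * h f) ≡ a * ∑ n h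
∑-* zero    a h = refl
∑-* (suc n) a h = trans (∑-cong n (λ f → sym (trans (*-distribˡ-+ a (h (red ∷ f) + h (green ∷ f)) _)
  (cong (_+ a * h (blue ∷ f)) (*-distribˡ-+ a (h (red ∷ f)) _))))) (∑-* n a _)

∑-∏ : ∀ n (k : Fin n → Color → ℕ) → ∑ n (λ f → ∏ (λ j → k j (f j))) ≡ ∏ (λ j → sumColor (k j))
∑-∏ zero    k = refl
∑-∏ (suc n) k =
  trans (∑-cong n (λ f → sumColor-*ʳ (k zero) (∏ (λ j → k (suc j) (f j)))))
    (trans (∑-* n (sumColor (k zero)) _) (cong (sumColor (k zero) *_) (∑-∏ n (λ j → k (suc j)))))

sum-concatMap : ∀ {A B : Set} (h : B → ℕ) (g : A → List B) (xs : List A) →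
  sum (map h (concatMap g xs)) ≡ sum (map (λ x → sum (map h (g x))) xs)
sum-concatMap h g L.[]       = refl
sum-concatMap h g (x L.∷ xs) = begin
  sum (map h (g x ++ concatMap g xs))              ≡⟨ cong sum (map-++ h (g x) (concatMap g xs)) ⟩
  sum (map h (g x) ++ map h (concatMap g xs))      ≡⟨ sum-++ (map h (g x)) (map h (concatMap g xs)) ⟩
  sum (map h (g x)) + sum (map h (concatMap g xs)) ≡⟨ cong (sum (map h (g x)) +_) (sum-concatMap h g xs) ⟩
  sum (map h (g x)) + sum (map (λ x → sum (map h (g x))) xs) ∎
  where open ≡-Reasoning

sum-allColorFuns : ∀ n (h : (Fin n → Color) → ℕ) → sum (map h (allColorFuns n)) ≡ ∑ n h
sum-allColorFuns zero    h = +-identityʳ _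
sum-allColorFuns (suc n) h =
  trans (sum-concatMap h (λ f → map (_∷ f) (red L.∷ green L.∷ blue L.∷ L.[])) (allColorFuns n))
    (trans (sum-allColorFuns n _) (∑-cong n (λ f → trans (cong (λ z → h (red ∷ f) + (h (green ∷ f) + z)) (+-identityʳ _))
                                                (sym (+-assoc (h (red ∷ f)) _ _)))))

length-filter≡sum : ∀ {A : Set} {P : A → Set} (P? : ∀ x → Dec (P x)) (xs : List A) →
  length (filter P? xs) ≡ sum (map (λ x → 𝟙 (does (P? x))) xs)
length-filter≡sum P? L.[] = refl
length-filter≡sum P? (x L.∷ xs) with does (P? x)
... | true  = cong suc (length-filter≡sum P? xs)
... | false = length-filter≡sum P? xs

Extensional : ∀ {n} → ((Fin n → Color) → ℕ) → Set
Extensional {n} h = ∀ f g → (∀ i → f i ≡ g i) → h f ≡ h g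

∑-Invariant : ∀ n → (Fin n → Fin n) → Set
∑-Invariant n σ = ∀ (h : (Fin n → Color) → ℕ) → Extensional h → ∑ n (λ f → h (f ∘ σ)) ≡ ∑ n h

∑-invariant-id : ∀ n → ∑-Invariant n id
∑-invariant-id n h e = refl

∑-invariant-∘ : ∀ n σ τ → ∑-Invariant n σ → ∑-Invariant n τ → ∑-Invariant n (σ ∘ τ)
∑-invariant-∘ n σ τ iσ iτ h e =
  trans (iσ (λ g → h (g ∘ τ)) (λ f g eq → e _ _ (eq ∘ τ))) (iτ h e)

liftFin : ∀ {n} → (Fin n → Fin n) → Fin (suc n) → Fin (suc n)
liftFin σ zero    = zero
liftFin σ (suc i) = suc (σ i)

∷-cong : ∀ {n} x {f g : Fin n → Color} → (∀ i → f i ≡ g i) → ∀ i → (x ∷ f) i ≡ (x ∷ g) i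
∷-cong x eq zero    = refl
∷-cong x eq (suc i) = eq i

∑-invariant-lift : ∀ n σ → ∑-Invariant n σ → ∑-Invariant (suc n) (liftFin σ)
∑-invariant-lift n σ iσ h e =
  trans (∑-cong n (λ g → sumColor-cong (λ x → e _ _ (∷-lift x g))))
    (iσ (λ g → sumColor (λ x → h (x ∷ g))) (λ f g eq → sumColor-cong (λ x → e _ _ (∷-cong x eq))))
  where
  ∷-lift : ∀ x (g : Fin n → Color) i → (x ∷ g) (liftFin σ i) ≡ (x ∷ (g ∘ σ)) i
  ∷-lift x g zero    = refl
  ∷-lift x g (suc i) = refl

swap₀₁ : ∀ {n} → Fin (suc (suc n)) → Fin (suc (suc n))
swap₀₁ zero          = suc zero
swap₀₁ (suc zero)    = zero
swap₀₁ (suc (suc i)) = suc (suc i)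

swap₀₁-involutive : ∀ {n} (i : Fin (suc (suc n))) → swap₀₁ (swap₀₁ i) ≡ i
swap₀₁-involutive zero          = refl
swap₀₁-involutive (suc zero)    = refl
swap₀₁-involutive (suc (suc i)) = refl

∑-invariant-swap : ∀ n → ∑-Invariant (suc (suc n)) swap₀₁
∑-invariant-swap n h e = ∑-cong n λ g →
  trans (sumColor-cong (λ y → sumColor-cong (λ x → e _ _ (∷∷-swap x y g))))
        (interchange (λ x y → h (x ∷ (y ∷ g))))
  where
  ∷∷-swap : ∀ x y (g : Fin n → Color) i → (x ∷ (y ∷ g)) (swap₀₁ i) ≡ (y ∷ (x ∷ g)) i
  ∷∷-swap x y g zero          = refl
  ∷∷-swap x y g (suc zero)    = refl
  ∷∷-swap x y g (suc (suc i)) = refl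
  interchange : ∀ (k : Color → Color → ℕ) →
    sumColor (λ y → sumColor (λ x → k y x)) ≡ sumColor (λ y → sumColor (λ x → k x y))
  interchange k = lemma (k red red) (k red green) (k red blue) (k green red) (k green green)
                        (k green blue) (k blue red) (k blue green) (k blue blue)
    where
    lemma : ∀ a b c d e f g h i →
      (a + b + c) + (d + e + f) + (g + h + i) ≡ (a + d + g) + (b + e + h) + (c + f + i)
    lemma = solve-∀


-- Good extensions

_==c_ : Color → Color → Bool
red   ==c red   = true
green ==c green = true
blue  ==c blue  = true
_     ==c _     = false

==c-true : ∀ {a b} → a ==c b ≡ true → a ≡ b
==c-true {red}   {red}   _ = refl
==c-true {green} {green} _ = refl
==c-true {blue}  {blue}  _ = refl
==c-true {red}   {green} ()
==c-true {red}   {blue}  ()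
==c-true {green} {red}   ()
==c-true {green} {blue}  ()
==c-true {blue}  {red}   ()
==c-true {blue}  {green} ()

==c-refl : ∀ a → a ==c a ≡ true
==c-refl red   = refl
==c-refl green = refl
==c-refl blue  = refl

==c-sym : ∀ a b → a ==c b ≡ b ==c a
==c-sym red   red   = refl
==c-sym red   green = refl
==c-sym red   blue  = refl
==c-sym green red   = refl
==c-sym green green = refl
==c-sym green blue  = refl
==c-sym blue  red   = refl
==c-sym blue  green = refl
==c-sym blue  blue  = refl

true≢false : ∀ {b} → b ≡ true → b ≡ false → ⊥
true≢false refl ()

-- Edges of colours a and b at the new vertex, opposite edge of colour c.
notRainbowᵇ : Color → Color → Color → Bool
notRainbowᵇ a b c = (a ==c b) ∨ ((b ==c c) ∨ (a ==c c))

notRainbowᵇ-true : ∀ a b c → notRainbowᵇ a b c ≡ true → (a ≡ b) ⊎ (b ≡ c) ⊎ (a ≡ c)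
notRainbowᵇ-true a b c e with a ==c b in e₁ | b ==c c in e₂ | a ==c c in e₃
... | true  | _     | _    = inj₁ (==c-true e₁)
... | false | true  | _    = inj₂ (inj₁ (==c-true e₂))
... | false | false | true = inj₂ (inj₂ (==c-true e₃))

notRainbowᵇ-false : ∀ a b c → notRainbowᵇ a b c ≡ false → (a ≢ b) × (b ≢ c) × (a ≢ c)
notRainbowᵇ-false a b c e with a ==c b in e₁ | b ==c c in e₂ | a ==c c in e₃
... | false | false | false =
  (λ { refl → true≢false (==c-refl a) e₁ }) ,
  (λ { refl → true≢false (==c-refl b) e₂ }) ,
  (λ { refl → true≢false (==c-refl a) e₃ })

notRainbowᵇ-swap : ∀ a b c → notRainbowᵇ a b c ≡ notRainbowᵇ b a c
notRainbowᵇ-swap a b c = cong₂ _∨_ (==c-sym a b) (∨-comm (b ==c c) (a ==c c))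

allᵇ : ∀ {n} → (Fin n → Bool) → Bool
allᵇ {zero}  b = true
allᵇ {suc n} b = b zero ∧ allᵇ (b ∘ suc)

∧-true : ∀ {a b} → a ∧ b ≡ true → (a ≡ true) × (b ≡ true)
∧-true {true} {true} _ = refl , refl

allᵇ-elim : ∀ {n} (b : Fin n → Bool) → allᵇ b ≡ true → ∀ j → b j ≡ true
allᵇ-elim b e zero    = proj₁ (∧-true e)
allᵇ-elim b e (suc j) = allᵇ-elim (b ∘ suc) (proj₂ (∧-true {b zero} e)) j

allᵇ-intro : ∀ {n} (b : Fin n → Bool) → (∀ j → b j ≡ true) → allᵇ b ≡ true
allᵇ-intro {zero}  b h = refl
allᵇ-intro {suc n} b h rewrite h zero = allᵇ-intro (b ∘ suc) (h ∘ suc)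

allᵇ-cong : ∀ {n} {b b′ : Fin n → Bool} → (∀ j → b j ≡ b′ j) → allᵇ b ≡ allᵇ b′
allᵇ-cong {zero}  eq = refl
allᵇ-cong {suc n} eq = cong₂ _∧_ (eq zero) (allᵇ-cong (eq ∘ suc))

-- The triangles through the new vertex and an old vertex of colour x (towards the new
-- vertex), whose other neighbours have colours g and are joined to it by edges coloured r.
rowOKᵇ : ∀ {n} → Color → (Fin n → Color) → (Fin n → Color) → Bool
rowOKᵇ x g r = allᵇ (λ j → notRainbowᵇ x (g j) (r j))

restrict : ∀ {m} → EdgeColoring (suc m) → EdgeColoring m
restrict φ i j = φ (suc i) (suc j)

goodᵇ : ∀ {n} → EdgeColoring n → (Fin n → Color) → Bool
goodᵇ {zero}  φ f = true
goodᵇ {suc n} φ f = rowOKᵇ (f zero) (f ∘ suc) (φ zero ∘ suc) ∧ goodᵇ (restrict φ) (f ∘ suc)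

Good : ∀ {n} → EdgeColoring n → (Fin n → Color) → Set
Good {n} φ f = ∀ (i j : Fin n) → i ≢ j → notRainbowᵇ (f i) (f j) (φ i j) ≡ true

goodᵇ⇒Good : ∀ {n} (φ : EdgeColoring n) → Symmetric φ → ∀ f → goodᵇ φ f ≡ true → Good φ f
goodᵇ⇒Good {suc n} φ sy f e zero    zero    ne = ⊥-elim (ne refl)
goodᵇ⇒Good {suc n} φ sy f e zero    (suc j) ne = allᵇ-elim _ (proj₁ (∧-true e)) j
goodᵇ⇒Good {suc n} φ sy f e (suc i) zero    ne =
  trans (cong (notRainbowᵇ (f (suc i)) (f zero)) (sy (suc i) zero ne))
    (trans (notRainbowᵇ-swap (f (suc i)) (f zero) _) (allᵇ-elim _ (proj₁ (∧-true e)) i))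
goodᵇ⇒Good {suc n} φ sy f e (suc i) (suc j) ne =
  goodᵇ⇒Good (restrict φ) (λ a b ne′ → sy (suc a) (suc b) (ne′ ∘ suc-injective))
    (f ∘ suc) (proj₂ (∧-true {rowOKᵇ (f zero) (f ∘ suc) (φ zero ∘ suc)} e)) i j (ne ∘ cong suc)

Good⇒goodᵇ : ∀ {n} (φ : EdgeColoring n) → ∀ f → Good φ f → goodᵇ φ f ≡ true
Good⇒goodᵇ {zero}  φ f g = refl
Good⇒goodᵇ {suc n} φ f g
  rewrite allᵇ-intro (λ j → notRainbowᵇ (f zero) (f (suc j)) (φ zero (suc j))) (λ j → g zero (suc j) (λ ()))
  = Good⇒goodᵇ (restrict φ) (f ∘ suc) (λ i j ne → g (suc i) (suc j) (ne ∘ suc-injective))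

goodᵇ-cong : ∀ {n} (φ ψ : EdgeColoring n) → (∀ i j → i ≢ j → φ i j ≡ ψ i j) →
  ∀ f g → (∀ i → f i ≡ g i) → goodᵇ φ f ≡ goodᵇ ψ g
goodᵇ-cong {zero}  φ ψ eφ f g ef = refl
goodᵇ-cong {suc n} φ ψ eφ f g ef =
  cong₂ _∧_ (allᵇ-cong (λ j → cong₂ (λ (x , y) z → notRainbowᵇ x y z)
                                     (cong₂ _,_ (ef zero) (ef (suc j))) (eφ zero (suc j) (λ ()))))
    (goodᵇ-cong (restrict φ) (restrict ψ) (λ i j ne → eφ (suc i) (suc j) (ne ∘ suc-injective)) _ _ (ef ∘ suc))

redBlue-notRainbow : ∀ {a b c : Color} → (a ≡ red ⊎ a ≡ blue) → (b ≡ red ⊎ b ≡ blue) →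
  (c ≡ red ⊎ c ≡ blue) → a ≢ b → b ≢ c → a ≢ c → ⊥
redBlue-notRainbow (inj₁ refl) (inj₁ refl) _           p q r = p refl
redBlue-notRainbow (inj₂ refl) (inj₂ refl) _           p q r = p refl
redBlue-notRainbow _           (inj₁ refl) (inj₁ refl) p q r = q refl
redBlue-notRainbow _           (inj₂ refl) (inj₂ refl) p q r = q refl
redBlue-notRainbow (inj₁ refl) (inj₂ refl) (inj₁ refl) p q r = r refl
redBlue-notRainbow (inj₂ refl) (inj₁ refl) (inj₂ refl) p q r = r refl

-- Only triangles through the new vertex can be rainbow: the old edges use two colours.
Good⇒Gallai : ∀ {n} (φ : EdgeColoring n) → RedBlue φ → ∀ f → Good φ f → Gallai (extend φ f)
Good⇒Gallai φ rb f g zero    zero    k       p q r _ = p refl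
Good⇒Gallai φ rb f g zero    (suc j) zero    p q r _ = r refl
Good⇒Gallai φ rb f g zero    (suc j) (suc k) p q r (ab , bc , ac)
  with notRainbowᵇ-true (f j) (f k) (φ j k) (g j k (q ∘ cong suc))
... | inj₁ e        = ac e
... | inj₂ (inj₁ e) = bc (sym e)
... | inj₂ (inj₂ e) = ab e
Good⇒Gallai φ rb f g (suc i) zero    zero    p q r _ = q refl
Good⇒Gallai φ rb f g (suc i) zero    (suc k) p q r (ab , bc , ac)
  with notRainbowᵇ-true (f i) (f k) (φ i k) (g i k (r ∘ cong suc))
... | inj₁ e        = ab e
... | inj₂ (inj₁ e) = bc e
... | inj₂ (inj₂ e) = ac e
Good⇒Gallai φ rb f g (suc i) (suc j) zero    p q r (ab , bc , ac)
  with notRainbowᵇ-true (f i) (f j) (φ i j) (g i j (p ∘ cong suc))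
... | inj₁ e        = bc (sym e)
... | inj₂ (inj₁ e) = ab (sym e)
... | inj₂ (inj₂ e) = ac (sym e)
Good⇒Gallai φ rb f g (suc i) (suc j) (suc k) p q r (ab , bc , ac) =
  redBlue-notRainbow (rb i j (p ∘ cong suc)) (rb j k (q ∘ cong suc)) (rb i k (r ∘ cong suc)) ab bc ac

Gallai⇒Good : ∀ {n} (φ : EdgeColoring n) → ∀ f → Gallai (extend φ f) → Good φ f
Gallai⇒Good φ f G i j ne with notRainbowᵇ (f i) (f j) (φ i j) in e
... | true  = refl
... | false with notRainbowᵇ-false _ _ _ e
... | ab , bc , ac = ⊥-elim (G zero (suc i) (suc j) (λ ()) (ne ∘ suc-injective) (λ ()) (ac , bc ∘ sym , ab))

w≡∑goodᵇ : ∀ {n} (φ : EdgeColoring n) → Symmetric φ → RedBlue φ → w φ ≡ ∑ n (𝟙 ∘ goodᵇ φ)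
w≡∑goodᵇ {n} φ sy rb =
  trans (length-filter≡sum (λ f → gallai? (extend φ f)) (allColorFuns n))
    (trans (cong sum (map-cong gallai?≡goodᵇ (allColorFuns n))) (sum-allColorFuns n _))
  where
  gallai?≡goodᵇ : ∀ f → 𝟙 (does (gallai? (extend φ f))) ≡ 𝟙 (goodᵇ φ f)
  gallai?≡goodᵇ f with goodᵇ φ f in e
  ... | true  = cong 𝟙 (dec-true (gallai? (extend φ f)) (Good⇒Gallai φ rb f (goodᵇ⇒Good φ sy f e)))
  ... | false = cong 𝟙 (dec-false (gallai? (extend φ f))
                         (λ G → true≢false (Good⇒goodᵇ φ f (Gallai⇒Good φ f G)) e))


-- Relabelling the vertices

-- A permutation of Fin n together with the invariance of ∑ under it; the latter is proved
-- for the generators (lifts and the transposition of 0 and 1) and closed under composition.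
record Relabelling (n : ℕ) : Set where
  field
    to      : Fin n → Fin n
    from    : Fin n → Fin n
    to-from : ∀ i → to (from i) ≡ i
    from-to : ∀ i → from (to i) ≡ i
    ∑-from  : ∑-Invariant n from
open Relabelling public

idᴿ : ∀ {n} → Relabelling n
idᴿ {n} = record { to = id ; from = id ; to-from = λ _ → refl ; from-to = λ _ → refl ; ∑-from = ∑-invariant-id n }

swapᴿ : ∀ {n} → Relabelling (suc (suc n))
swapᴿ {n} = record { to = swap₀₁ ; from = swap₀₁ ; to-from = swap₀₁-involutive ; from-to = swap₀₁-involutive
                   ; ∑-from = ∑-invariant-swap n }

liftᴿ : ∀ {n} → Relabelling n → Relabelling (suc n)
liftᴿ {n} σ = record { to = liftFin (to σ) ; from = liftFin (from σ) ; to-from = to-from′ ; from-to = from-to′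
                     ; ∑-from = ∑-invariant-lift n (from σ) (∑-from σ) }
  where
  to-from′ : ∀ i → liftFin (to σ) (liftFin (from σ) i) ≡ i
  to-from′ zero    = refl
  to-from′ (suc i) = cong suc (to-from σ i)
  from-to′ : ∀ i → liftFin (from σ) (liftFin (to σ) i) ≡ i
  from-to′ zero    = refl
  from-to′ (suc i) = cong suc (from-to σ i)

_∘ᴿ_ : ∀ {n} → Relabelling n → Relabelling n → Relabelling n
_∘ᴿ_ {n} σ τ = record
  { to      = to σ ∘ to τ
  ; from    = from τ ∘ from σ
  ; to-from = λ i → trans (cong (to σ) (to-from τ (from σ i))) (to-from σ i)
  ; from-to = λ i → trans (cong (from τ) (from-to σ (to τ i))) (from-to τ i)
  ; ∑-from  = ∑-invariant-∘ n (from τ) (from σ) (∑-from τ) (∑-from σ) }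

to-injective : ∀ {n} (σ : Relabelling n) {i j} → to σ i ≡ to σ j → i ≡ j
to-injective σ {i} {j} e = trans (sym (from-to σ i)) (trans (cong (from σ) e) (from-to σ j))

from-injective : ∀ {n} (σ : Relabelling n) {i j} → from σ i ≡ from σ j → i ≡ j
from-injective σ {i} {j} e = trans (sym (to-from σ i)) (trans (cong (to σ) e) (to-from σ j))

sending₀ : ∀ {n} → Fin (suc n) → Relabelling (suc n)
sending₀ zero                  = idᴿ
sending₀ {suc n} (suc zero)    = swapᴿ
sending₀ {suc n} (suc (suc k)) = swapᴿ ∘ᴿ (liftᴿ (sending₀ (suc k)) ∘ᴿ swapᴿ)

sending₀-zero : ∀ {n} (v : Fin (suc n)) → to (sending₀ v) zero ≡ v
sending₀-zero zero                  = refl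
sending₀-zero {suc n} (suc zero)    = refl
sending₀-zero {suc n} (suc (suc k)) rewrite sending₀-zero (suc k) = refl

sending₀₁ : ∀ {n} (a b : Fin (suc (suc n))) → a ≢ b →
  Σ (Relabelling (suc (suc n))) λ σ → (to σ zero ≡ a) × (to σ (suc zero) ≡ b)
sending₀₁ a b a≢b with from (sending₀ a) b in eb
... | zero   = ⊥-elim (a≢b (trans (sym (sending₀-zero a)) (trans (cong (to (sending₀ a)) (sym eb)) (to-from (sending₀ a) b))))
... | suc b′ = (sending₀ a ∘ᴿ liftᴿ (sending₀ b′)) , sending₀-zero a ,
  trans (cong (to (sending₀ a) ∘ suc) (sending₀-zero b′)) (trans (cong (to (sending₀ a)) (sym eb)) (to-from (sending₀ a) b))

relabel : ∀ {n} → Relabelling n → EdgeColoring n → EdgeColoring n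
relabel σ φ i j = φ (to σ i) (to σ j)

relabel-symmetric : ∀ {n} σ (φ : EdgeColoring n) → Symmetric φ → Symmetric (relabel σ φ)
relabel-symmetric σ φ sy i j ne = sy _ _ (ne ∘ to-injective σ)

relabel-redBlue : ∀ {n} σ (φ : EdgeColoring n) → RedBlue φ → RedBlue (relabel σ φ)
relabel-redBlue σ φ rb i j ne = rb _ _ (ne ∘ to-injective σ)

true⇔true⇒≡ : ∀ {a b : Bool} → (a ≡ true → b ≡ true) → (b ≡ true → a ≡ true) → a ≡ b
true⇔true⇒≡ {true}  {true}  p q = refl
true⇔true⇒≡ {false} {false} p q = refl
true⇔true⇒≡ {true}  {false} p q = sym (p refl)
true⇔true⇒≡ {false} {true}  p q = q refl

w-relabel : ∀ {n} (σ : Relabelling n) (φ : EdgeColoring n) → Symmetric φ → RedBlue φ → w (relabel σ φ) ≡ w φ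
w-relabel {n} σ φ sy rb = begin
  w (relabel σ φ)                       ≡⟨ w≡∑goodᵇ (relabel σ φ) (relabel-symmetric σ φ sy) (relabel-redBlue σ φ rb) ⟩
  ∑ n (𝟙 ∘ goodᵇ (relabel σ φ))         ≡⟨ ∑-cong n (λ f → cong 𝟙 (true⇔true⇒≡ (good⇒good∘from f) (good∘from⇒good f))) ⟩
  ∑ n (λ f → 𝟙 (goodᵇ φ (f ∘ from σ)))  ≡⟨ ∑-from σ (𝟙 ∘ goodᵇ φ) (λ f g e → cong 𝟙 (goodᵇ-cong φ φ (λ _ _ _ → refl) f g e)) ⟩
  ∑ n (𝟙 ∘ goodᵇ φ)                     ≡⟨ w≡∑goodᵇ φ sy rb ⟨
  w φ                                   ∎
  where
  open ≡-Reasoning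
  good⇒good∘from : ∀ f → goodᵇ (relabel σ φ) f ≡ true → goodᵇ φ (f ∘ from σ) ≡ true
  good⇒good∘from f e = Good⇒goodᵇ φ _ λ i j ne →
    subst₂ (λ a b → notRainbowᵇ (f (from σ i)) (f (from σ j)) (φ a b) ≡ true) (to-from σ i) (to-from σ j)
      (goodᵇ⇒Good (relabel σ φ) (relabel-symmetric σ φ sy) f e (from σ i) (from σ j) (ne ∘ from-injective σ))
  good∘from⇒good : ∀ f → goodᵇ φ (f ∘ from σ) ≡ true → goodᵇ (relabel σ φ) f ≡ true
  good∘from⇒good f e = Good⇒goodᵇ (relabel σ φ) f λ i j ne →
    subst₂ (λ a b → notRainbowᵇ (f a) (f b) (φ (to σ i) (to σ j)) ≡ true) (from-to σ i) (from-to σ j)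
      (goodᵇ⇒Good φ sy _ e (to σ i) (to σ j) (ne ∘ to-injective σ))


-- Splitting off a vertex

sameColorsᵇ : ∀ {n} → (Fin n → Color) → (Fin n → Color) → Bool
sameColorsᵇ g r = allᵇ (λ j → g j ==c r j)

∑-sameColorsᵇ : ∀ n (r : Fin n → Color) → ∑ n (λ g → 𝟙 (sameColorsᵇ g r)) ≡ 1
∑-sameColorsᵇ zero    r = refl
∑-sameColorsᵇ (suc n) r =
  trans (∑-cong n (λ g → one (r zero) (sameColorsᵇ g (r ∘ suc)))) (∑-sameColorsᵇ n (r ∘ suc))
  where
  one : ∀ c b → sumColor (λ x → 𝟙 ((x ==c c) ∧ b)) ≡ 𝟙 b
  one red   true  = refl
  one red   false = refl
  one green true  = refl
  one green false = refl
  one blue  true  = refl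
  one blue  false = refl

notRainbowᵇ-allColours : ∀ a c → (c ≡ red ⊎ c ≡ blue) →
  notRainbowᵇ red a c ∧ (notRainbowᵇ green a c ∧ notRainbowᵇ blue a c) ≡ true → a ==c c ≡ true
notRainbowᵇ-allColours red   red   _ e = refl
notRainbowᵇ-allColours blue  blue  _ e = refl
notRainbowᵇ-allColours green red   _ ()
notRainbowᵇ-allColours green blue  _ ()
notRainbowᵇ-allColours red   blue  _ ()
notRainbowᵇ-allColours blue  red   _ ()
notRainbowᵇ-allColours a     green (inj₁ ()) e
notRainbowᵇ-allColours a     green (inj₂ ()) e

rowOKᵇ-allColours : ∀ {n} (g r : Fin n → Color) → (∀ j → r j ≡ red ⊎ r j ≡ blue) →
  rowOKᵇ red g r ∧ (rowOKᵇ green g r ∧ rowOKᵇ blue g r) ≡ true → sameColorsᵇ g r ≡ true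
rowOKᵇ-allColours g r rb e = allᵇ-intro _ λ j → notRainbowᵇ-allColours (g j) (r j) (rb j)
  (let (a , bc) = ∧-true e ; (b , c) = ∧-true bc in
   ∧-intro (allᵇ-elim _ a j) (∧-intro (allᵇ-elim _ b j) (allᵇ-elim _ c j)))
  where
  ∧-intro : ∀ {a b} → a ≡ true → b ≡ true → a ∧ b ≡ true
  ∧-intro refl refl = refl

𝟙≤1 : ∀ b → 𝟙 b ≤ 1
𝟙≤1 true  = ≤-refl
𝟙≤1 false = z≤n

𝟙-three≤ : ∀ a b c e → (a ∧ (b ∧ c) ≡ true → e ≡ true) → 𝟙 a + 𝟙 b + 𝟙 c ≤ 2 + 𝟙 e
𝟙-three≤ true  true  true  e h rewrite h refl = ≤-refl
𝟙-three≤ true  true  false e h = s≤s (s≤s z≤n)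
𝟙-three≤ true  false c     e h = s≤s (≤-trans (𝟙≤1 c) (s≤s z≤n))
𝟙-three≤ false b     c     e h = ≤-trans (+-mono-≤ (𝟙≤1 b) (𝟙≤1 c)) (m≤m+n 2 (𝟙 e))

𝟙-three-∧≤ : ∀ a b c g e → (a ∧ (b ∧ c) ≡ true → e ≡ true) →
  𝟙 (a ∧ g) + 𝟙 (b ∧ g) + 𝟙 (c ∧ g) ≤ 2 * 𝟙 g + 𝟙 e
𝟙-three-∧≤ a b c false e h rewrite ∧-zeroʳ a | ∧-zeroʳ b | ∧-zeroʳ c = z≤n
𝟙-three-∧≤ a b c true  e h rewrite ∧-identityʳ a | ∧-identityʳ b | ∧-identityʳ c = 𝟙-three≤ a b c e h

restrict-symmetric : ∀ {m} (φ : EdgeColoring (suc m)) → Symmetric φ → Symmetric (restrict φ)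
restrict-symmetric φ sy i j ne = sy (suc i) (suc j) (ne ∘ suc-injective)

restrict-redBlue : ∀ {m} (φ : EdgeColoring (suc m)) → RedBlue φ → RedBlue (restrict φ)
restrict-redBlue φ rb i j ne = rb (suc i) (suc j) (ne ∘ suc-injective)

-- A good vector g on the other vertices has at most two good extensions to vertex 0, unless
-- all three colours work; that forces g to copy the (red/blue) row of vertex 0.
w-restrict-≤ : ∀ {m} (φ : EdgeColoring (suc m)) → Symmetric φ → RedBlue φ → w φ ≤ 2 * w (restrict φ) + 1
w-restrict-≤ {m} φ sy rb = begin
  w φ                                                       ≡⟨ w≡∑goodᵇ φ sy rb ⟩
  ∑ m (λ g → sumColor (λ x → 𝟙 (rowOKᵇ x g r ∧ goodᵇ φ′ g)))
    ≤⟨ ∑-mono-≤ m (λ g → 𝟙-three-∧≤ (rowOKᵇ red g r) (rowOKᵇ green g r) (rowOKᵇ blue g r) (goodᵇ φ′ g)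
                          (sameColorsᵇ g r) (rowOKᵇ-allColours g r (λ j → rb zero (suc j) (λ ())))) ⟩
  ∑ m (λ g → 2 * 𝟙 (goodᵇ φ′ g) + 𝟙 (sameColorsᵇ g r))       ≡⟨ ∑-+ m _ _ ⟩
  ∑ m (λ g → 2 * 𝟙 (goodᵇ φ′ g)) + ∑ m (λ g → 𝟙 (sameColorsᵇ g r))
                                                            ≡⟨ cong₂ _+_ (∑-* m 2 _) (∑-sameColorsᵇ m r) ⟩
  2 * ∑ m (𝟙 ∘ goodᵇ φ′) + 1
    ≡⟨ cong (λ z → 2 * z + 1) (w≡∑goodᵇ φ′ (restrict-symmetric φ sy) (restrict-redBlue φ rb)) ⟨
  2 * w φ′ + 1                                              ∎
  where
  open ≤-Reasoning
  φ′ : EdgeColoring m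
  φ′ = restrict φ
  r : Fin m → Color
  r = φ zero ∘ suc


-- Two-apex colourings

-- K_m monochromatic in c, plus two apexes 0 and 1 joined by an edge of colour e and
-- joined to the vertices of K_m by edges coloured r and s respectively.
twoApex : ∀ {m} → Color → Color → (Fin m → Color) → (Fin m → Color) → EdgeColoring (suc (suc m))
twoApex c e r s zero          zero          = red
twoApex c e r s zero          (suc zero)    = e
twoApex c e r s zero          (suc (suc j)) = r j
twoApex c e r s (suc zero)    zero          = e
twoApex c e r s (suc zero)    (suc zero)    = red
twoApex c e r s (suc zero)    (suc (suc j)) = s j
twoApex c e r s (suc (suc i)) zero          = r i
twoApex c e r s (suc (suc i)) (suc zero)    = s i
twoApex c e r s (suc (suc i)) (suc (suc j)) = c

data IsRB : Color → Set where
  isR : IsRB red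
  isB : IsRB blue

opp : Color → Color
opp red   = blue
opp blue  = red
opp green = green

notGreenᵇ : Color → Bool
notGreenᵇ a = not (a ==c green)

notOppᵇ : Color → Color → Bool
notOppᵇ c a = not (a ==c opp c)

allᵇ-∧ : ∀ {n} (b b′ : Fin n → Bool) → allᵇ b ∧ allᵇ b′ ≡ allᵇ (λ j → b j ∧ b′ j)
allᵇ-∧ {zero}  b b′ = refl
allᵇ-∧ {suc n} b b′ with b zero | b′ zero
... | true  | true  = allᵇ-∧ (b ∘ suc) (b′ ∘ suc)
... | true  | false = ∧-zeroʳ (allᵇ (b ∘ suc))
... | false | _     = refl

notRainbowᵇ-same : ∀ {c} → IsRB c → ∀ a → notRainbowᵇ c a c ≡ true
notRainbowᵇ-same isR red   = refl
notRainbowᵇ-same isR green = refl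
notRainbowᵇ-same isR blue  = refl
notRainbowᵇ-same isB red   = refl
notRainbowᵇ-same isB green = refl
notRainbowᵇ-same isB blue  = refl

notRainbowᵇ-green : ∀ {c} → IsRB c → ∀ a → notRainbowᵇ green a c ≡ notOppᵇ c a
notRainbowᵇ-green isR red   = refl
notRainbowᵇ-green isR green = refl
notRainbowᵇ-green isR blue  = refl
notRainbowᵇ-green isB red   = refl
notRainbowᵇ-green isB green = refl
notRainbowᵇ-green isB blue  = refl

notRainbowᵇ-opp : ∀ {c} → IsRB c → ∀ a → notRainbowᵇ (opp c) a c ≡ notGreenᵇ a
notRainbowᵇ-opp isR red   = refl
notRainbowᵇ-opp isR green = refl
notRainbowᵇ-opp isR blue  = refl
notRainbowᵇ-opp isB red   = refl
notRainbowᵇ-opp isB green = refl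
notRainbowᵇ-opp isB blue  = refl

∧-abs-∨ʳ : ∀ a b → b ∧ (a ∨ b) ≡ b
∧-abs-∨ʳ a b = trans (cong (b ∧_) (∨-comm a b)) (∧-abs-∨ b a)

∧-abs-∨-false : ∀ a b → a ∧ (a ∨ b) ≡ a ∨ false
∧-abs-∨-false a b = trans (∧-abs-∨ a b) (sym (∨-identityʳ a))

goodᵇ-monochromatic : ∀ {m c} → IsRB c → (h : Fin m → Color) →
  goodᵇ {m} (λ _ _ → c) h ≡ allᵇ (notGreenᵇ ∘ h) ∨ allᵇ (notOppᵇ c ∘ h)
goodᵇ-monochromatic {zero}  rc  h = refl
goodᵇ-monochromatic {suc m} isR h with h zero
... | red   rewrite allᵇ-intro _ (notRainbowᵇ-same isR ∘ h ∘ suc) | goodᵇ-monochromatic isR (h ∘ suc) = refl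
... | green rewrite allᵇ-cong (notRainbowᵇ-green isR ∘ h ∘ suc) | goodᵇ-monochromatic isR (h ∘ suc) = ∧-abs-∨ʳ _ _
... | blue  rewrite allᵇ-cong (notRainbowᵇ-opp isR ∘ h ∘ suc)   | goodᵇ-monochromatic isR (h ∘ suc) = ∧-abs-∨-false _ _
goodᵇ-monochromatic {suc m} isB h with h zero
... | blue  rewrite allᵇ-intro _ (notRainbowᵇ-same isB ∘ h ∘ suc) | goodᵇ-monochromatic isB (h ∘ suc) = refl
... | green rewrite allᵇ-cong (notRainbowᵇ-green isB ∘ h ∘ suc) | goodᵇ-monochromatic isB (h ∘ suc) = ∧-abs-∨ʳ _ _
... | red   rewrite allᵇ-cong (notRainbowᵇ-opp isB ∘ h ∘ suc)   | goodᵇ-monochromatic isB (h ∘ suc) = ∧-abs-∨-false _ _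

𝟙-∧ : ∀ a b → 𝟙 (a ∧ b) ≡ 𝟙 a * 𝟙 b
𝟙-∧ true  b = sym (+-identityʳ (𝟙 b))
𝟙-∧ false b = refl

𝟙-allᵇ : ∀ {n} (b : Fin n → Bool) → 𝟙 (allᵇ b) ≡ ∏ (𝟙 ∘ b)
𝟙-allᵇ {zero}  b = refl
𝟙-allᵇ {suc n} b = trans (𝟙-∧ (b zero) _) (cong (𝟙 (b zero) *_) (𝟙-allᵇ (b ∘ suc)))

∑-sumColor : ∀ m (F : Color → (Fin m → Color) → ℕ) → ∑ m (λ h → sumColor (λ x → F x h)) ≡ sumColor (λ x → ∑ m (F x))
∑-sumColor m F = trans (∑-+ m _ _) (cong (_+ ∑ m (F blue)) (∑-+ m _ _))

sumColor² : (Color → Color → ℕ) → ℕ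
sumColor² F = sumColor (λ y → sumColor (λ x → F x y))

sumColor²-cong : ∀ {F G : Color → Color → ℕ} → (∀ x y → F x y ≡ G x y) → sumColor² F ≡ sumColor² G
sumColor²-cong e = sumColor-cong (λ y → sumColor-cong (λ x → e x y))

sumColor²-+ : ∀ (F G : Color → Color → ℕ) → sumColor² (λ x y → F x y + G x y) ≡ sumColor² F + sumColor² G
sumColor²-+ F G = trans (sumColor-cong (λ y → sumColor-+ (λ x → F x y) (λ x → G x y)))
                        (sumColor-+ (λ y → sumColor (λ x → F x y)) (λ y → sumColor (λ x → G x y)))

∑-sumColor² : ∀ m (F : Color → Color → (Fin m → Color) → ℕ) →
  ∑ m (λ h → sumColor² (λ x y → F x y h)) ≡ sumColor² (λ x y → ∑ m (F x y))
∑-sumColor² m F = trans (∑-sumColor m (λ y h → sumColor (λ x → F x y h))) (sumColor-cong (λ y → ∑-sumColor m (λ x h → F x y h)))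

-- The number of colours a for a vertex of K_m that are allowed by D and compatible with apex
-- colours x and y, when its edges to the apexes have colours α and β.
choices : Color → Color → (Color → Bool) → Color → Color → ℕ
choices x y D α β = sumColor (λ a → 𝟙 (notRainbowᵇ x a α ∧ (notRainbowᵇ y a β ∧ D a)))

𝟙-inclusion-exclusion : ∀ k₁ k₂ k₃ A B → 𝟙 ((k₁ ∧ k₂) ∧ (k₃ ∧ (A ∨ B))) + 𝟙 (k₁ ∧ (k₂ ∧ (k₃ ∧ (A ∧ B))))
                                      ≡ 𝟙 (k₁ ∧ (k₂ ∧ (k₃ ∧ A))) + 𝟙 (k₁ ∧ (k₂ ∧ (k₃ ∧ B)))
𝟙-inclusion-exclusion true  true  true  true  true  = refl
𝟙-inclusion-exclusion true  true  true  true  false = refl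
𝟙-inclusion-exclusion true  true  true  false true  = refl
𝟙-inclusion-exclusion true  true  true  false false = refl
𝟙-inclusion-exclusion true  true  false A     B     = refl
𝟙-inclusion-exclusion true  false k₃    A     B     = refl
𝟙-inclusion-exclusion false k₂    k₃    A     B     = refl

module TwoApex {m : ℕ} (c e : Color) (r s : Fin m → Color) where

  wApex : ℕ
  wApex = ∑ (suc (suc m)) (𝟙 ∘ goodᵇ (twoApex c e r s))

  goodWith : Color → Color → (Color → Bool) → (Fin m → Color) → ℕ
  goodWith x y D h = 𝟙 (notRainbowᵇ x y e ∧ (rowOKᵇ x h r ∧ (rowOKᵇ y h s ∧ allᵇ (D ∘ h))))

  ∑goodWith : ∀ x y D → ∑ m (goodWith x y D) ≡ 𝟙 (notRainbowᵇ x y e) * ∏ (λ j → choices x y D (r j) (s j))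
  ∑goodWith x y D =
    trans (∑-cong m factor)
      (trans (∑-* m (𝟙 (notRainbowᵇ x y e)) _) (cong (𝟙 (notRainbowᵇ x y e) *_) (∑-∏ m allowed)))
    where
    allowed : Fin m → Color → ℕ
    allowed j a = 𝟙 (notRainbowᵇ x a (r j) ∧ (notRainbowᵇ y a (s j) ∧ D a))
    factor : ∀ h → goodWith x y D h ≡ 𝟙 (notRainbowᵇ x y e) * ∏ (λ j → allowed j (h j))
    factor h = trans (𝟙-∧ (notRainbowᵇ x y e) _) (cong (𝟙 (notRainbowᵇ x y e) *_)
      (trans (cong 𝟙 (trans (cong (rowOKᵇ x h r ∧_) (allᵇ-∧ (λ j → notRainbowᵇ y (h j) (s j)) (D ∘ h)))
                            (allᵇ-∧ (λ j → notRainbowᵇ x (h j) (r j)) (λ j → notRainbowᵇ y (h j) (s j) ∧ D (h j)))))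
             (𝟙-allᵇ (λ j → notRainbowᵇ x (h j) (r j) ∧ (notRainbowᵇ y (h j) (s j) ∧ D (h j))))))

  avoidGreen avoidOpp avoidBoth : Color → Bool
  avoidGreen = notGreenᵇ
  avoidOpp   = notOppᵇ c
  avoidBoth a = notGreenᵇ a ∧ notOppᵇ c a

  wApex-inclusion-exclusion : IsRB c →
    wApex + sumColor² (λ x y → ∑ m (goodWith x y avoidBoth))
      ≡ sumColor² (λ x y → ∑ m (goodWith x y avoidGreen) + ∑ m (goodWith x y avoidOpp))
  wApex-inclusion-exclusion rc = begin
    wApex + sumColor² (λ x y → ∑ m (goodWith x y avoidBoth))
      ≡⟨ cong (wApex +_) (∑-sumColor² m (λ x y → goodWith x y avoidBoth)) ⟨
    wApex + ∑ m (λ h → sumColor² (λ x y → goodWith x y avoidBoth h))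
      ≡⟨ ∑-+ m (λ h → sumColor² (λ x y → 𝟙 (goodᵇ (twoApex c e r s) (x ∷ (y ∷ h)))))
               (λ h → sumColor² (λ x y → goodWith x y avoidBoth h)) ⟨
    ∑ m (λ h → sumColor² (λ x y → 𝟙 (goodᵇ (twoApex c e r s) (x ∷ (y ∷ h)))) + sumColor² (λ x y → goodWith x y avoidBoth h))
      ≡⟨ ∑-cong m (λ h → trans (sym (sumColor²-+ (λ x y → 𝟙 (goodᵇ (twoApex c e r s) (x ∷ (y ∷ h)))) (λ x y → goodWith x y avoidBoth h)))
                                (sumColor²-cong (pointwise h))) ⟩
    ∑ m (λ h → sumColor² (λ x y → goodWith x y avoidGreen h + goodWith x y avoidOpp h))
      ≡⟨ ∑-sumColor² m (λ x y h → goodWith x y avoidGreen h + goodWith x y avoidOpp h) ⟩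
    sumColor² (λ x y → ∑ m (λ h → goodWith x y avoidGreen h + goodWith x y avoidOpp h))
      ≡⟨ sumColor²-cong (λ x y → ∑-+ m (goodWith x y avoidGreen) (goodWith x y avoidOpp)) ⟩
    sumColor² (λ x y → ∑ m (goodWith x y avoidGreen) + ∑ m (goodWith x y avoidOpp)) ∎
    where
    open ≡-Reasoning
    pointwise : ∀ h x y → 𝟙 (goodᵇ (twoApex c e r s) (x ∷ (y ∷ h))) + goodWith x y avoidBoth h
                            ≡ goodWith x y avoidGreen h + goodWith x y avoidOpp h
    pointwise h x y rewrite goodᵇ-monochromatic rc h | sym (allᵇ-∧ (notGreenᵇ ∘ h) (notOppᵇ c ∘ h)) =
      𝟙-inclusion-exclusion (notRainbowᵇ x y e) (rowOKᵇ x h r) (rowOKᵇ y h s) _ _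

SameOrOpp : Color → Color → Set
SameOrOpp c a = (a ≡ c) ⊎ (a ≡ opp c)

==c-opp : ∀ {c} → IsRB c → c ==c opp c ≡ false
==c-opp isR = refl
==c-opp isB = refl

opp==c : ∀ {c} → IsRB c → opp c ==c c ≡ false
opp==c isR = refl
opp==c isB = refl

count : ∀ {m} → (Fin m → Bool) → ℕ
count {zero}  b = 0
count {suc m} b = 𝟙 (b zero) + count (b ∘ suc)

hasType : ∀ {m} → Color → Color → (Fin m → Color) → (Fin m → Color) → Fin m → Bool
hasType α β r s j = (r j ==c α) ∧ (s j ==c β)

#cc #co #oc #oo : ∀ {m} → Color → (Fin m → Color) → (Fin m → Color) → ℕ
#cc c r s = count (hasType c c r s)
#co c r s = count (hasType c (opp c) r s)
#oc c r s = count (hasType (opp c) c r s)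
#oo c r s = count (hasType (opp c) (opp c) r s)

private
  +-suc-second : ∀ a b c d → a + suc b + c + d ≡ suc (a + b + c + d)
  +-suc-second = solve-∀
  +-suc-third : ∀ a b c d → a + b + suc c + d ≡ suc (a + b + c + d)
  +-suc-third = solve-∀
  +-suc-fourth : ∀ a b c d → a + b + c + suc d ≡ suc (a + b + c + d)
  +-suc-fourth = solve-∀
  shift₁ : ∀ a x y z v → a * (x * y * z * v) ≡ a * x * y * z * v
  shift₁ = solve-∀
  shift₂ : ∀ a x y z v → a * (x * y * z * v) ≡ x * (a * y) * z * v
  shift₂ = solve-∀
  shift₃ : ∀ a x y z v → a * (x * y * z * v) ≡ x * y * (a * z) * v
  shift₃ = solve-∀
  shift₄ : ∀ a x y z v → a * (x * y * z * v) ≡ x * y * z * (a * v)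
  shift₄ = solve-∀

∏-byType : ∀ {m c} → IsRB c → (r s : Fin m → Color) → (∀ j → SameOrOpp c (r j)) → (∀ j → SameOrOpp c (s j)) →
  (W : Color → Color → ℕ) →
  ∏ (λ j → W (r j) (s j)) ≡ W c c ^ #cc c r s * W c (opp c) ^ #co c r s
                           * W (opp c) c ^ #oc c r s * W (opp c) (opp c) ^ #oo c r s
∏-byType {zero}      rc r s rr rs W = refl
∏-byType {suc m} {c} rc r s rr rs W with r zero | rr zero | s zero | rs zero
                                        | ∏-byType rc (r ∘ suc) (s ∘ suc) (rr ∘ suc) (rs ∘ suc) W
... | _ | inj₁ refl | _ | inj₁ refl | IH rewrite ==c-refl c | ==c-opp rc =
  trans (cong (W c c *_) IH) (shift₁ (W c c)
      (W c c ^ #cc c (r ∘ suc) (s ∘ suc)) (W c (opp c) ^ #co c (r ∘ suc) (s ∘ suc))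
      (W (opp c) c ^ #oc c (r ∘ suc) (s ∘ suc)) (W (opp c) (opp c) ^ #oo c (r ∘ suc) (s ∘ suc)))
... | _ | inj₁ refl | _ | inj₂ refl | IH rewrite ==c-refl c | ==c-opp rc | ==c-refl (opp c) | opp==c rc =
  trans (cong (W c (opp c) *_) IH) (shift₂ (W c (opp c))
      (W c c ^ #cc c (r ∘ suc) (s ∘ suc)) (W c (opp c) ^ #co c (r ∘ suc) (s ∘ suc))
      (W (opp c) c ^ #oc c (r ∘ suc) (s ∘ suc)) (W (opp c) (opp c) ^ #oo c (r ∘ suc) (s ∘ suc)))
... | _ | inj₂ refl | _ | inj₁ refl | IH rewrite ==c-refl c | ==c-opp rc | ==c-refl (opp c) | opp==c rc =
  trans (cong (W (opp c) c *_) IH) (shift₃ (W (opp c) c)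
      (W c c ^ #cc c (r ∘ suc) (s ∘ suc)) (W c (opp c) ^ #co c (r ∘ suc) (s ∘ suc))
      (W (opp c) c ^ #oc c (r ∘ suc) (s ∘ suc)) (W (opp c) (opp c) ^ #oo c (r ∘ suc) (s ∘ suc)))
... | _ | inj₂ refl | _ | inj₂ refl | IH rewrite ==c-refl (opp c) | opp==c rc =
  trans (cong (W (opp c) (opp c) *_) IH) (shift₄ (W (opp c) (opp c))
      (W c c ^ #cc c (r ∘ suc) (s ∘ suc)) (W c (opp c) ^ #co c (r ∘ suc) (s ∘ suc))
      (W (opp c) c ^ #oc c (r ∘ suc) (s ∘ suc)) (W (opp c) (opp c) ^ #oo c (r ∘ suc) (s ∘ suc)))

#types-sum : ∀ {m c} → IsRB c → (r s : Fin m → Color) → (∀ j → SameOrOpp c (r j)) → (∀ j → SameOrOpp c (s j)) →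
  #cc c r s + #co c r s + #oc c r s + #oo c r s ≡ m
#types-sum {zero}      rc r s rr rs = refl
#types-sum {suc m} {c} rc r s rr rs with r zero | rr zero | s zero | rs zero
                                        | #types-sum rc (r ∘ suc) (s ∘ suc) (rr ∘ suc) (rs ∘ suc)
... | _ | inj₁ refl | _ | inj₁ refl | IH rewrite ==c-refl c | ==c-opp rc = cong suc IH
... | _ | inj₁ refl | _ | inj₂ refl | IH rewrite ==c-refl c | ==c-opp rc | ==c-refl (opp c) | opp==c rc =
  trans (+-suc-second (#cc c (r ∘ suc) (s ∘ suc)) (#co c (r ∘ suc) (s ∘ suc))
                          (#oc c (r ∘ suc) (s ∘ suc)) (#oo c (r ∘ suc) (s ∘ suc)))
        (cong suc IH)
... | _ | inj₂ refl | _ | inj₁ refl | IH rewrite ==c-refl c | ==c-opp rc | ==c-refl (opp c) | opp==c rc =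
  trans (+-suc-third (#cc c (r ∘ suc) (s ∘ suc)) (#co c (r ∘ suc) (s ∘ suc))
                          (#oc c (r ∘ suc) (s ∘ suc)) (#oo c (r ∘ suc) (s ∘ suc)))
        (cong suc IH)
... | _ | inj₂ refl | _ | inj₂ refl | IH rewrite ==c-refl (opp c) | opp==c rc =
  trans (+-suc-fourth (#cc c (r ∘ suc) (s ∘ suc)) (#co c (r ∘ suc) (s ∘ suc))
                          (#oc c (r ∘ suc) (s ∘ suc)) (#oo c (r ∘ suc) (s ∘ suc)))
        (cong suc IH)

-- The exact value of wApex in terms of the type counts p q t u, through the atoms
-- A_ = 2 ^ _ and Z_ = 0 ^ _; the correction term sits on the left so that no subtraction occurs.
correction : (ZQ ZT ZU : ℕ) → ℕ
correction ZQ ZT ZU = 2 + ZU * (ZQ + ZT) + ZQ * ZT * ZU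

closedSame closedOpp : (AP AQ AT AU ZQ ZT ZU : ℕ) → ℕ
closedSame AP AQ AT AU ZQ ZT ZU = 4 * (AP * AQ * AT * AU) + 2 * AP + AQ + AT + AU + 2 * AP * ZU + ZQ * ZT
closedOpp AP AQ AT AU ZQ ZT ZU = 4 * (AP * AQ * AT * AU) + 2 * AP + AQ + AT + AU + AQ * ZT + AT * ZQ + ZQ * ZT

-- v ^ k for the values v ≤ 2 that occur, with 2 ^ k and 0 ^ k as atoms for the ring solver.
smallPow : ℕ → ℕ → ℕ → ℕ → ℕ
smallPow 0 k A Z = Z
smallPow 1 k A Z = 1
smallPow 2 k A Z = A
smallPow (suc (suc (suc v))) k A Z = suc (suc (suc v)) ^ k

^≡smallPow : ∀ v k → v ^ k ≡ smallPow v k (2 ^ k) (0 ^ k)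
^≡smallPow 0 k = refl
^≡smallPow 1 k = ^-zeroˡ k
^≡smallPow 2 k = refl
^≡smallPow (suc (suc (suc v))) k = refl

apexSum : Color → Color → (Color → Bool) → (p q t u AP AQ AT AU ZP ZQ ZT ZU : ℕ) → ℕ
apexSum c e D p q t u AP AQ AT AU ZP ZQ ZT ZU = sumColor² (λ x y → 𝟙 (notRainbowᵇ x y e) *
   (smallPow (choices x y D c c) p AP ZP * smallPow (choices x y D c (opp c)) q AQ ZQ * smallPow (choices x y D (opp c) c) t AT ZT * smallPow (choices x y D (opp c) (opp c)) u AU ZU))

-- The left-hand sides are the normal forms of the apexSum expressions in apexSum-rr … apexSum-bb.
apexSum-rrⁿᶠ : ∀ (AP AQ AT AU ZP ZQ ZT ZU : ℕ) → (AP * AQ * AT * AU + 0 + 1 + (AP * AQ * AT * AU + 0) + (1 + ((ZQ + 0) * ZT * 1 + 0 + 0)) + (AP * AQ * AT * AU + 0 + 0 + (AP * AQ * AT * AU + 0))) + (AP * 1 * 1 * 1 + 0 + (AP * 1 * 1 * ZU + 0) + ((AT + 0) * 1 + 0) + (AP * 1 * 1 * ZU + 0 + (AP * 1 * 1 * 1 + 0) + 0) + ((AQ + 0) * 1 * 1 + 0 + 0 + (AU + 0 + 0))) + (2 + ZU * (ZQ + ZT) + ZQ * ZT * ZU) ≡ ((1 + ((ZT + 0) * ZU + 0 + 1 + ((ZQ + 0) * 1 * ZU + 0 + ((ZQ + 0) * ZT * ZU + 0) + 0) + 2))) + (4 * (AP * AQ * AT * AU) + 2 * AP + AQ + AT +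 AU + 2 * AP * ZU + ZQ * ZT)
apexSum-rrⁿᶠ = solve-∀

apexSum-rbⁿᶠ : ∀ (AP AQ AT AU ZP ZQ ZT ZU : ℕ) → (AP * AQ * AT * AU + 0 + 0 + (AP * AQ * AT * AU + 0) + ((ZQ + 0) * ZT * 1 + 0 + 1) + (AP * AQ * AT * AU + 0 + 1 + (AP * AQ * AT * AU + 0))) + (AP * 1 * 1 * 1 + 0 + 0 + ((AT + 0) * 1 + 0) + (AP * 1 * 1 * 1 + 0 + ((ZQ + 0) * AT * 1 + 0)) + ((AQ + 0) * 1 * 1 + 0 + ((AQ + 0) * ZT * 1 + 0) + (AU + 0 + 0))) + (2 + ZU * (ZQ + ZT) + ZQ * ZT * ZU) ≡ ((2 + ((ZQ + 0) * ZT * ZU + 0 + ((ZQ + 0) * 1 * ZU + 0) + (1 + ((ZT + 0) * ZU + 0 + 1))))) + (4 * (AP * AQ * AT * AU) + 2 * AP + AQ + AT + AU + AQ * ZT + AT * ZQ + ZQ * ZT)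
apexSum-rbⁿᶠ = solve-∀

apexSum-brⁿᶠ : ∀ (AP AQ AT AU ZP ZQ ZT ZU : ℕ) → (AP * AQ * AT * AU + 0 + 1 + (AP * AQ * AT * AU + 0) + (1 + ((ZQ + 0) * ZT * 1 + 0 + 0)) + (AP * AQ * AT * AU + 0 + 0 + (AP * AQ * AT * AU + 0))) + (AU + 0 + 0 + ((AQ + 0) * ZT * 1 + 0) + ((AQ + 0) * 1 * 1 + 0) + ((ZQ + 0) * AT * 1 + 0 + (AP * 1 * 1 * 1 + 0) + 0) + ((AT + 0) * 1 + 0 + 0 + (AP * 1 * 1 * 1 + 0))) + (2 + ZU * (ZQ + ZT) + ZQ * ZT * ZU) ≡ ((1 + ((ZT + 0) * ZU + 0 + 1 + ((ZQ + 0) * 1 * ZU + 0 + ((ZQ + 0) * ZT * ZU + 0) + 0) + 2))) + (4 * (AP * AQ * AT * AU) + 2 * AP + AQ + AT + AU + AQ * ZT + AT * ZQ + ZQ * ZT)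
apexSum-brⁿᶠ = solve-∀

apexSum-bbⁿᶠ : ∀ (AP AQ AT AU ZP ZQ ZT ZU : ℕ) → (AP * AQ * AT * AU + 0 + 0 + (AP * AQ * AT * AU + 0) + ((ZQ + 0) * ZT * 1 + 0 + 1) + (AP * AQ * AT * AU + 0 + 1 + (AP * AQ * AT * AU + 0))) + (AU + 0 + 0 + 0 + ((AQ + 0) * 1 * 1 + 0) + (AP * 1 * 1 * 1 + 0 + (AP * 1 * 1 * ZU + 0)) + ((AT + 0) * 1 + 0 + (AP * 1 * 1 * ZU + 0) + (AP * 1 * 1 * 1 + 0))) + (2 + ZU * (ZQ + ZT) + ZQ * ZT * ZU) ≡ ((2 + ((ZQ + 0) * ZT * ZU + 0 + ((ZQ + 0) * 1 * ZU + 0) + (1 + ((ZT + 0) * ZU + 0 + 1))))) + (4 * (AP * AQ * AT * AU) + 2 * AP + AQ + AT + AU + 2 * AP * ZU + ZQ * ZT)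
apexSum-bbⁿᶠ = solve-∀

module _ (p q t u AP AQ AT AU ZP ZQ ZT ZU : ℕ) where
  apexSum′ : Color → Color → (Color → Bool) → ℕ
  apexSum′ c e D = apexSum c e D p q t u AP AQ AT AU ZP ZQ ZT ZU

  apexSum-rr : apexSum′ red red notGreenᵇ + apexSum′ red red (notOppᵇ red) + correction ZQ ZT ZU
             ≡ apexSum′ red red (λ a → notGreenᵇ a ∧ notOppᵇ red a) + closedSame AP AQ AT AU ZQ ZT ZU
  apexSum-rr = apexSum-rrⁿᶠ AP AQ AT AU ZP ZQ ZT ZU

  apexSum-rb : apexSum′ red blue notGreenᵇ + apexSum′ red blue (notOppᵇ red) + correction ZQ ZT ZU
             ≡ apexSum′ red blue (λ a → notGreenᵇ a ∧ notOppᵇ red a) + closedOpp AP AQ AT AU ZQ ZT ZU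
  apexSum-rb = apexSum-rbⁿᶠ AP AQ AT AU ZP ZQ ZT ZU

  apexSum-br : apexSum′ blue red notGreenᵇ + apexSum′ blue red (notOppᵇ blue) + correction ZQ ZT ZU
             ≡ apexSum′ blue red (λ a → notGreenᵇ a ∧ notOppᵇ blue a) + closedOpp AP AQ AT AU ZQ ZT ZU
  apexSum-br = apexSum-brⁿᶠ AP AQ AT AU ZP ZQ ZT ZU

  apexSum-bb : apexSum′ blue blue notGreenᵇ + apexSum′ blue blue (notOppᵇ blue) + correction ZQ ZT ZU
             ≡ apexSum′ blue blue (λ a → notGreenᵇ a ∧ notOppᵇ blue a) + closedSame AP AQ AT AU ZQ ZT ZU
  apexSum-bb = apexSum-bbⁿᶠ AP AQ AT AU ZP ZQ ZT ZU

+-transfer : ∀ {W B G L R} → W + B ≡ G → G + L ≡ B + R → W + L ≡ R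
+-transfer {W} {B} {G} {L} {R} h e = +-cancelʳ-≡ B _ _ (begin
  W + L + B   ≡⟨ swap W L B ⟩
  W + B + L   ≡⟨ cong (_+ L) h ⟩
  G + L       ≡⟨ e ⟩
  B + R       ≡⟨ +-comm B R ⟩
  R + B       ∎)
  where
  open ≡-Reasoning
  swap : ∀ a b c → a + b + c ≡ a + c + b
  swap = solve-∀

module ApexCount {m : ℕ} (c e : Color) (r s : Fin m → Color)
                 (rc : IsRB c) (rr : ∀ j → SameOrOpp c (r j)) (rs : ∀ j → SameOrOpp c (s j)) where
  open TwoApex c e r s using (goodWith; wApex; wApex-inclusion-exclusion; avoidGreen; avoidOpp; avoidBoth)

  p q t u : ℕ
  p = #cc c r s
  q = #co c r s
  t = #oc c r s
  u = #oo c r s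

  term : Color → Color → (Color → Bool) → ℕ
  term x y D = 𝟙 (notRainbowᵇ x y e) *
    (smallPow (choices x y D c c) p (2 ^ p) (0 ^ p) * smallPow (choices x y D c (opp c)) q (2 ^ q) (0 ^ q)
      * smallPow (choices x y D (opp c) c) t (2 ^ t) (0 ^ t) * smallPow (choices x y D (opp c) (opp c)) u (2 ^ u) (0 ^ u))

  apexSumAt : (Color → Bool) → ℕ
  apexSumAt D = apexSum c e D p q t u (2 ^ p) (2 ^ q) (2 ^ t) (2 ^ u) (0 ^ p) (0 ^ q) (0 ^ t) (0 ^ u)

  ∑goodWith≡term : ∀ x y D → ∑ m (goodWith x y D) ≡ term x y D
  ∑goodWith≡term x y D = trans (TwoApex.∑goodWith c e r s x y D) (cong (𝟙 (notRainbowᵇ x y e) *_)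
    (trans (∏-byType rc r s rr rs (choices x y D))
      (cong₂ _*_ (cong₂ _*_ (cong₂ _*_ (^≡smallPow _ p) (^≡smallPow _ q)) (^≡smallPow _ t)) (^≡smallPow _ u))))

  wApex+apexSum : wApex + apexSumAt avoidBoth ≡ apexSumAt avoidGreen + apexSumAt avoidOpp
  wApex+apexSum = begin
    wApex + apexSumAt avoidBoth
      ≡⟨ cong (wApex +_) (sumColor²-cong (λ x y → ∑goodWith≡term x y avoidBoth)) ⟨
    wApex + sumColor² (λ x y → ∑ m (goodWith x y avoidBoth))
      ≡⟨ wApex-inclusion-exclusion rc ⟩
    sumColor² (λ x y → ∑ m (goodWith x y avoidGreen) + ∑ m (goodWith x y avoidOpp))
      ≡⟨ sumColor²-cong (λ x y → cong₂ _+_ (∑goodWith≡term x y avoidGreen) (∑goodWith≡term x y avoidOpp)) ⟩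
    sumColor² (λ x y → term x y avoidGreen + term x y avoidOpp)
      ≡⟨ sumColor²-+ (λ x y → term x y avoidGreen) (λ x y → term x y avoidOpp) ⟩
    apexSumAt avoidGreen + apexSumAt avoidOpp ∎
    where open ≡-Reasoning

  ClosedForm : Set
  ClosedForm =
    (e ≡ c → wApex + correction (0 ^ q) (0 ^ t) (0 ^ u) ≡ closedSame (2 ^ p) (2 ^ q) (2 ^ t) (2 ^ u) (0 ^ q) (0 ^ t) (0 ^ u)) ×
    (e ≢ c → wApex + correction (0 ^ q) (0 ^ t) (0 ^ u) ≡ closedOpp (2 ^ p) (2 ^ q) (2 ^ t) (2 ^ u) (0 ^ q) (0 ^ t) (0 ^ u))

  wApex-closedForm : IsRB e → ClosedForm
  wApex-closedForm = byColours rc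
    where
    byColours : IsRB c → IsRB e → ClosedForm
    byColours isR isR =
      (λ _ → +-transfer wApex+apexSum (apexSum-rr p q t u (2 ^ p) (2 ^ q) (2 ^ t) (2 ^ u) (0 ^ p) (0 ^ q) (0 ^ t) (0 ^ u))) ,
      (λ ne → ⊥-elim (ne refl))
    byColours isR isB =
      (λ ()) ,
      (λ _ → +-transfer wApex+apexSum (apexSum-rb p q t u (2 ^ p) (2 ^ q) (2 ^ t) (2 ^ u) (0 ^ p) (0 ^ q) (0 ^ t) (0 ^ u)))
    byColours isB isR =
      (λ ()) ,
      (λ _ → +-transfer wApex+apexSum (apexSum-br p q t u (2 ^ p) (2 ^ q) (2 ^ t) (2 ^ u) (0 ^ p) (0 ^ q) (0 ^ t) (0 ^ u)))
    byColours isB isB =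
      (λ _ → +-transfer wApex+apexSum (apexSum-bb p q t u (2 ^ p) (2 ^ q) (2 ^ t) (2 ^ u) (0 ^ p) (0 ^ q) (0 ^ t) (0 ^ u))) ,
      (λ ne → ⊥-elim (ne refl))

2^≡suc : ∀ k → Σ ℕ λ a → 2 ^ k ≡ suc a
2^≡suc k = 2 ^ k ∸ 1 , sym (m+[n∸m]≡n (m^n>0 2 k))

+1≤-by-slack : ∀ W L R B d → W + L ≡ R → R + 1 + d ≡ B + L → W + 1 ≤ B
+1≤-by-slack W L R B d h e = ≤-trans (m≤m+n (W + 1) d)
  (≤-reflexive (+-cancelʳ-≡ L _ _ (trans (reorder W L d) (trans (cong (λ z → z + 1 + d) h) e))))
  where
  reorder : ∀ W L d → W + 1 + d + L ≡ W + L + 1 + d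
  reorder = solve-∀

-- Either the bound holds, or the counts are those of a monochromatic or a special colouring.
BoundSame : ℕ → ℕ → ℕ → ℕ → ℕ → Set
BoundSame p q t u W = (W + 1 ≤ 6 * (2 ^ p * 2 ^ q * 2 ^ t * 2 ^ u))
  ⊎ (q ≡ 0 × t ≡ 0 × u ≡ 0) ⊎ (q ≡ 0 × u ≡ 0 × t ≡ 1) ⊎ (t ≡ 0 × u ≡ 0 × q ≡ 1)

BoundOpp : ℕ → ℕ → ℕ → ℕ → ℕ → Set
BoundOpp p q t u W = (W + 1 ≤ 6 * (2 ^ p * 2 ^ q * 2 ^ t * 2 ^ u))
  ⊎ (q ≡ 0 × t ≡ 0 × u ≡ 0) ⊎ (p ≡ 0 × q ≡ 0 × t ≡ 0 × u ≡ 2) ⊎ (p ≡ 1 × q ≡ 0 × t ≡ 0 × u ≡ 1)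
  ⊎ (p ≡ 0 × q ≡ 0 × u ≡ 0) ⊎ (p ≡ 0 × t ≡ 0 × u ≡ 0)

closedSame⇒bound : ∀ p q t u W → 2 ≤ p + q + t + u →
  W + correction (0 ^ q) (0 ^ t) (0 ^ u) ≡ closedSame (2 ^ p) (2 ^ q) (2 ^ t) (2 ^ u) (0 ^ q) (0 ^ t) (0 ^ u) →
  BoundSame p q t u W
closedSame⇒bound kp 0 0 0 W m2 = λ h → inj₂ (inj₁ (refl , refl , refl))
closedSame⇒bound kp 0 1 0 W m2 = λ h → inj₂ (inj₂ (inj₁ (refl , refl , refl)))
closedSame⇒bound kp 0 (suc (suc kt)) 0 W m2 with 2^≡suc kp | 2^≡suc kt
... | (ap , ep) | (at , et) rewrite ep | et =
  λ h → inj₁ (+1≤-by-slack W _ _ _ (4 * ap + 8 * ap * at + 4 * at) h (slack ap at))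
  where
  slack : ∀ (ap at : ℕ) → (4 * ((suc ap) * 1 * (2 * (2 * (suc at))) * 1) + 2 * (suc ap) + 1 + (2 * (2 * (suc at))) + 1 + 2 * (suc ap) * 1 + 1 * 0) + 1 + (4 * ap + 8 * ap * at + 4 * at)
          ≡ 6 * ((suc ap) * 1 * (2 * (2 * (suc at))) * 1) + (2 + 1 * (1 + 0) + 1 * 0 * 1)
  slack = solve-∀
closedSame⇒bound kp 1 0 0 W m2 = λ h → inj₂ (inj₂ (inj₂ (refl , refl , refl)))
closedSame⇒bound kp (suc (suc kq)) 0 0 W m2 with 2^≡suc kp | 2^≡suc kq
... | (ap , ep) | (aq , eq) rewrite ep | eq =
  λ h → inj₁ (+1≤-by-slack W _ _ _ (4 * ap + 8 * ap * aq + 4 * aq) h (slack ap aq))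
  where
  slack : ∀ (ap aq : ℕ) → (4 * ((suc ap) * (2 * (2 * (suc aq))) * 1 * 1) + 2 * (suc ap) + (2 * (2 * (suc aq))) + 1 + 1 + 2 * (suc ap) * 1 + 0 * 1) + 1 + (4 * ap + 8 * ap * aq + 4 * aq)
          ≡ 6 * ((suc ap) * (2 * (2 * (suc aq))) * 1 * 1) + (2 + 1 * (0 + 1) + 0 * 1 * 1)
  slack = solve-∀
closedSame⇒bound kp (suc kq) (suc kt) 0 W m2 with 2^≡suc kp | 2^≡suc kq | 2^≡suc kt
... | (ap , ep) | (aq , eq) | (at , et) rewrite ep | eq | et =
  λ h → inj₁ (+1≤-by-slack W _ _ _ (4 * ap + 8 * ap * aq + 8 * ap * aq * at + 8 * ap * at + 6 * aq + 8 * aq * at + 6 * at) h (slack ap aq at))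
  where
  slack : ∀ (ap aq at : ℕ) → (4 * ((suc ap) * (2 * (suc aq)) * (2 * (suc at)) * 1) + 2 * (suc ap) + (2 * (suc aq)) + (2 * (suc at)) + 1 + 2 * (suc ap) * 1 + 0 * 0) + 1 + (4 * ap + 8 * ap * aq + 8 * ap * aq * at + 8 * ap * at + 6 * aq + 8 * aq * at + 6 * at)
          ≡ 6 * ((suc ap) * (2 * (suc aq)) * (2 * (suc at)) * 1) + (2 + 1 * (0 + 0) + 0 * 0 * 1)
  slack = solve-∀
closedSame⇒bound 0 0 0 1 W (s≤s ())
closedSame⇒bound (suc kp) 0 0 1 W m2 with 2^≡suc kp
... | (ap , ep) rewrite ep = λ h → inj₁ (+1≤-by-slack W _ _ _ (4 * ap) h (slack ap))
  where
  slack : ∀ (ap : ℕ) → (4 * ((2 * (suc ap)) * 1 * 1 * 2) + 2 * (2 * (suc ap)) + 1 + 1 + 2 + 2 * (2 * (suc ap)) * 0 + 1 * 1) + 1 + (4 * ap)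
          ≡ 6 * ((2 * (suc ap)) * 1 * 1 * 2) + (2 + 0 * (1 + 1) + 1 * 1 * 0)
  slack = solve-∀
closedSame⇒bound kp 0 0 (suc (suc ku)) W m2 with 2^≡suc kp | 2^≡suc ku
... | (ap , ep) | (au , eu) rewrite ep | eu =
  λ h → inj₁ (+1≤-by-slack W _ _ _ (6 * ap + 8 * ap * au + 4 * au) h (slack ap au))
  where
  slack : ∀ (ap au : ℕ) → (4 * ((suc ap) * 1 * 1 * (2 * (2 * (suc au)))) + 2 * (suc ap) + 1 + 1 + (2 * (2 * (suc au))) + 2 * (suc ap) * 0 + 1 * 1) + 1 + (6 * ap + 8 * ap * au + 4 * au)
          ≡ 6 * ((suc ap) * 1 * 1 * (2 * (2 * (suc au)))) + (2 + 0 * (1 + 1) + 1 * 1 * 0)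
  slack = solve-∀
closedSame⇒bound kp (suc kq) 0 (suc ku) W m2 with 2^≡suc kp | 2^≡suc kq | 2^≡suc ku
... | (ap , ep) | (aq , eq) | (au , eu) rewrite ep | eq | eu =
  λ h → inj₁ (+1≤-by-slack W _ _ _ (2 + 6 * ap + 8 * ap * aq + 8 * ap * aq * au + 8 * ap * au + 6 * aq + 8 * aq * au + 6 * au) h (slack ap aq au))
  where
  slack : ∀ (ap aq au : ℕ) → (4 * ((suc ap) * (2 * (suc aq)) * 1 * (2 * (suc au))) + 2 * (suc ap) + (2 * (suc aq)) + 1 + (2 * (suc au)) + 2 * (suc ap) * 0 + 0 * 1) + 1 + (2 + 6 * ap + 8 * ap * aq + 8 * ap * aq * au + 8 * ap * au + 6 * aq + 8 * aq * au + 6 * au)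
          ≡ 6 * ((suc ap) * (2 * (suc aq)) * 1 * (2 * (suc au))) + (2 + 0 * (0 + 1) + 0 * 1 * 0)
  slack = solve-∀
closedSame⇒bound kp 0 (suc kt) (suc ku) W m2 with 2^≡suc kp | 2^≡suc kt | 2^≡suc ku
... | (ap , ep) | (at , et) | (au , eu) rewrite ep | et | eu =
  λ h → inj₁ (+1≤-by-slack W _ _ _ (2 + 6 * ap + 8 * ap * at + 8 * ap * at * au + 8 * ap * au + 6 * at + 8 * at * au + 6 * au) h (slack ap at au))
  where
  slack : ∀ (ap at au : ℕ) → (4 * ((suc ap) * 1 * (2 * (suc at)) * (2 * (suc au))) + 2 * (suc ap) + 1 + (2 * (suc at)) + (2 * (suc au)) + 2 * (suc ap) * 0 + 1 * 0) + 1 + (2 + 6 * ap + 8 * ap * at + 8 * ap * at * au + 8 * ap * au + 6 * at + 8 * at * au + 6 * au)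
          ≡ 6 * ((suc ap) * 1 * (2 * (suc at)) * (2 * (suc au))) + (2 + 0 * (1 + 0) + 1 * 0 * 0)
  slack = solve-∀
closedSame⇒bound kp (suc kq) (suc kt) (suc ku) W m2 with 2^≡suc kp | 2^≡suc kq | 2^≡suc kt | 2^≡suc ku
... | (ap , ep) | (aq , eq) | (at , et) | (au , eu) rewrite ep | eq | et | eu =
  λ h → inj₁ (+1≤-by-slack W _ _ _ (9 + 14 * ap + 16 * ap * aq + 16 * ap * aq * at + 16 * ap * aq * at * au + 16 * ap * aq * au + 16 * ap * at + 16 * ap * at * au + 16 * ap * au + 14 * aq + 16 * aq * at + 16 * aq * at * au + 16 * aq * au + 14 * at + 16 * at * au + 14 * au) h (slack ap aq at au))
  where
  slack : ∀ (ap aq at au : ℕ) → (4 * ((suc ap) * (2 * (suc aq)) * (2 * (suc at)) * (2 * (suc au))) + 2 * (suc ap) + (2 * (suc aq)) + (2 * (suc at)) + (2 * (suc au)) + 2 * (suc ap) * 0 + 0 * 0) + 1 + (9 + 14 * ap + 16 * ap * aq + 16 * ap * aq * at + 16 * ap * aq * at * au + 16 * ap * aq * au + 16 * ap * at + 16 * ap * at * au + 16 * ap * au + 14 * aq + 16 * aq * at + 16 * aq * at * au + 16 * aq * au + 14 * at + 16 * at * au + 14 * au)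
          ≡ 6 * ((suc ap) * (2 * (suc aq)) * (2 * (suc at)) * (2 * (suc au))) + (2 + 0 * (0 + 0) + 0 * 0 * 0)
  slack = solve-∀

closedOpp⇒bound : ∀ p q t u W → 2 ≤ p + q + t + u →
  W + correction (0 ^ q) (0 ^ t) (0 ^ u) ≡ closedOpp (2 ^ p) (2 ^ q) (2 ^ t) (2 ^ u) (0 ^ q) (0 ^ t) (0 ^ u) →
  BoundOpp p q t u W
closedOpp⇒bound kp 0 0 0 W m2 = λ h → inj₂ (inj₁ (refl , refl , refl))
closedOpp⇒bound 0 0 0 1 W (s≤s ())
closedOpp⇒bound 1 0 0 1 W m2 = λ h → inj₂ (inj₂ (inj₂ (inj₁ (refl , refl , refl , refl))))
closedOpp⇒bound (suc (suc kp)) 0 0 1 W m2 with 2^≡suc kp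
... | (ap , ep) rewrite ep = λ h → inj₁ (+1≤-by-slack W _ _ _ (2 + 8 * ap) h (slack ap))
  where
  slack : ∀ (ap : ℕ) → (4 * ((2 * (2 * (suc ap))) * 1 * 1 * 2) + 2 * (2 * (2 * (suc ap))) + 1 + 1 + 2 + 1 * 1 + 1 * 1 + 1 * 1) + 1 + (2 + 8 * ap)
          ≡ 6 * ((2 * (2 * (suc ap))) * 1 * 1 * 2) + (2 + 0 * (1 + 1) + 1 * 1 * 0)
  slack = solve-∀
closedOpp⇒bound 0 0 0 2 W m2 = λ h → inj₂ (inj₂ (inj₁ (refl , refl , refl , refl)))
closedOpp⇒bound (suc kp) 0 0 2 W m2 with 2^≡suc kp
... | (ap , ep) rewrite ep = λ h → inj₁ (+1≤-by-slack W _ _ _ (4 + 12 * ap) h (slack ap))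
  where
  slack : ∀ (ap : ℕ) → (4 * ((2 * (suc ap)) * 1 * 1 * 4) + 2 * (2 * (suc ap)) + 1 + 1 + 4 + 1 * 1 + 1 * 1 + 1 * 1) + 1 + (4 + 12 * ap)
          ≡ 6 * ((2 * (suc ap)) * 1 * 1 * 4) + (2 + 0 * (1 + 1) + 1 * 1 * 0)
  slack = solve-∀
closedOpp⇒bound kp 0 0 (suc (suc (suc ku))) W m2 with 2^≡suc kp | 2^≡suc ku
... | (ap , ep) | (au , eu) rewrite ep | eu =
  λ h → inj₁ (+1≤-by-slack W _ _ _ (2 + 14 * ap + 16 * ap * au + 8 * au) h (slack ap au))
  where
  slack : ∀ (ap au : ℕ) → (4 * ((suc ap) * 1 * 1 * (2 * (2 * (2 * (suc au))))) + 2 * (suc ap) + 1 + 1 + (2 * (2 * (2 * (suc au)))) + 1 * 1 + 1 * 1 + 1 * 1) + 1 + (2 + 14 * ap + 16 * ap * au + 8 * au)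
          ≡ 6 * ((suc ap) * 1 * 1 * (2 * (2 * (2 * (suc au))))) + (2 + 0 * (1 + 1) + 1 * 1 * 0)
  slack = solve-∀
closedOpp⇒bound 0 0 (suc kt) 0 W m2 = λ h → inj₂ (inj₂ (inj₂ (inj₂ (inj₁ (refl , refl , refl)))))
closedOpp⇒bound (suc kp) 0 (suc kt) 0 W m2 with 2^≡suc kp | 2^≡suc kt
... | (ap , ep) | (at , et) rewrite ep | et =
  λ h → inj₁ (+1≤-by-slack W _ _ _ (4 * ap + 8 * ap * at + 4 * at) h (slack ap at))
  where
  slack : ∀ (ap at : ℕ) → (4 * ((2 * (suc ap)) * 1 * (2 * (suc at)) * 1) + 2 * (2 * (suc ap)) + 1 + (2 * (suc at)) + 1 + 1 * 0 + (2 * (suc at)) * 1 + 1 * 0) + 1 + (4 * ap + 8 * ap * at + 4 * at)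
          ≡ 6 * ((2 * (suc ap)) * 1 * (2 * (suc at)) * 1) + (2 + 1 * (1 + 0) + 1 * 0 * 1)
  slack = solve-∀
closedOpp⇒bound kp 0 (suc kt) (suc ku) W m2 with 2^≡suc kp | 2^≡suc kt | 2^≡suc ku
... | (ap , ep) | (at , et) | (au , eu) rewrite ep | et | eu =
  λ h → inj₁ (+1≤-by-slack W _ _ _ (6 * ap + 8 * ap * at + 8 * ap * at * au + 8 * ap * au + 4 * at + 8 * at * au + 6 * au) h (slack ap at au))
  where
  slack : ∀ (ap at au : ℕ) → (4 * ((suc ap) * 1 * (2 * (suc at)) * (2 * (suc au))) + 2 * (suc ap) + 1 + (2 * (suc at)) + (2 * (suc au)) + 1 * 0 + (2 * (suc at)) * 1 + 1 * 0) + 1 + (6 * ap + 8 * ap * at + 8 * ap * at * au + 8 * ap * au + 4 * at + 8 * at * au + 6 * au)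
          ≡ 6 * ((suc ap) * 1 * (2 * (suc at)) * (2 * (suc au))) + (2 + 0 * (1 + 0) + 1 * 0 * 0)
  slack = solve-∀
closedOpp⇒bound 0 (suc kq) 0 0 W m2 = λ h → inj₂ (inj₂ (inj₂ (inj₂ (inj₂ (refl , refl , refl)))))
closedOpp⇒bound (suc kp) (suc kq) 0 0 W m2 with 2^≡suc kp | 2^≡suc kq
... | (ap , ep) | (aq , eq) rewrite ep | eq =
  λ h → inj₁ (+1≤-by-slack W _ _ _ (4 * ap + 8 * ap * aq + 4 * aq) h (slack ap aq))
  where
  slack : ∀ (ap aq : ℕ) → (4 * ((2 * (suc ap)) * (2 * (suc aq)) * 1 * 1) + 2 * (2 * (suc ap)) + (2 * (suc aq)) + 1 + 1 + (2 * (suc aq)) * 1 + 1 * 0 + 0 * 1) + 1 + (4 * ap + 8 * ap * aq + 4 * aq)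
          ≡ 6 * ((2 * (suc ap)) * (2 * (suc aq)) * 1 * 1) + (2 + 1 * (0 + 1) + 0 * 1 * 1)
  slack = solve-∀
closedOpp⇒bound kp (suc kq) 0 (suc ku) W m2 with 2^≡suc kp | 2^≡suc kq | 2^≡suc ku
... | (ap , ep) | (aq , eq) | (au , eu) rewrite ep | eq | eu =
  λ h → inj₁ (+1≤-by-slack W _ _ _ (6 * ap + 8 * ap * aq + 8 * ap * aq * au + 8 * ap * au + 4 * aq + 8 * aq * au + 6 * au) h (slack ap aq au))
  where
  slack : ∀ (ap aq au : ℕ) → (4 * ((suc ap) * (2 * (suc aq)) * 1 * (2 * (suc au))) + 2 * (suc ap) + (2 * (suc aq)) + 1 + (2 * (suc au)) + (2 * (suc aq)) * 1 + 1 * 0 + 0 * 1) + 1 + (6 * ap + 8 * ap * aq + 8 * ap * aq * au + 8 * ap * au + 4 * aq + 8 * aq * au + 6 * au)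
          ≡ 6 * ((suc ap) * (2 * (suc aq)) * 1 * (2 * (suc au))) + (2 + 0 * (0 + 1) + 0 * 1 * 0)
  slack = solve-∀
closedOpp⇒bound kp (suc kq) (suc kt) 0 W m2 with 2^≡suc kp | 2^≡suc kq | 2^≡suc kt
... | (ap , ep) | (aq , eq) | (at , et) rewrite ep | eq | et =
  λ h → inj₁ (+1≤-by-slack W _ _ _ (2 + 6 * ap + 8 * ap * aq + 8 * ap * aq * at + 8 * ap * at + 6 * aq + 8 * aq * at + 6 * at) h (slack ap aq at))
  where
  slack : ∀ (ap aq at : ℕ) → (4 * ((suc ap) * (2 * (suc aq)) * (2 * (suc at)) * 1) + 2 * (suc ap) + (2 * (suc aq)) + (2 * (suc at)) + 1 + (2 * (suc aq)) * 0 + (2 * (suc at)) * 0 + 0 * 0) + 1 + (2 + 6 * ap + 8 * ap * aq + 8 * ap * aq * at + 8 * ap * at + 6 * aq + 8 * aq * at + 6 * at)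
          ≡ 6 * ((suc ap) * (2 * (suc aq)) * (2 * (suc at)) * 1) + (2 + 1 * (0 + 0) + 0 * 0 * 1)
  slack = solve-∀
closedOpp⇒bound kp (suc kq) (suc kt) (suc ku) W m2 with 2^≡suc kp | 2^≡suc kq | 2^≡suc kt | 2^≡suc ku
... | (ap , ep) | (aq , eq) | (at , et) | (au , eu) rewrite ep | eq | et | eu =
  λ h → inj₁ (+1≤-by-slack W _ _ _ (9 + 14 * ap + 16 * ap * aq + 16 * ap * aq * at + 16 * ap * aq * at * au + 16 * ap * aq * au + 16 * ap * at + 16 * ap * at * au + 16 * ap * au + 14 * aq + 16 * aq * at + 16 * aq * at * au + 16 * aq * au + 14 * at + 16 * at * au + 14 * au) h (slack ap aq at au))
  where
  slack : ∀ (ap aq at au : ℕ) → (4 * ((suc ap) * (2 * (suc aq)) * (2 * (suc at)) * (2 * (suc au))) + 2 * (suc ap) + (2 * (suc aq)) + (2 * (suc at)) + (2 * (suc au)) + (2 * (suc aq)) * 0 + (2 * (suc at)) * 0 + 0 * 0) + 1 + (9 + 14 * ap + 16 * ap * aq + 16 * ap * aq * at + 16 * ap * aq * at * au + 16 * ap * aq * au + 16 * ap * at + 16 * ap * at * au + 16 * ap * au + 14 * aq + 16 * aq * at + 16 * aq * at * au + 16 * aq * au + 14 * at + 16 * at * au + 14 * au)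
          ≡ 6 * ((suc ap) * (2 * (suc aq)) * (2 * (suc at)) * (2 * (suc au))) + (2 + 0 * (0 + 0) + 0 * 0 * 0)
  slack = solve-∀


-- Recognising special colourings

vertexSpecial : ∀ {n} (ψ : EdgeColoring n) → Symmetric ψ → (v a b : Fin n) → a ≢ b → v ≢ a → v ≢ b →
  (c₁ c₂ : Color) → c₁ ≢ c₂ → (∀ j → v ≢ j → ψ v j ≡ c₁) →
  (∀ i j → i ≢ j → i ≢ v → j ≢ v → ψ i j ≡ c₂) → Special ψ
vertexSpecial ψ sy v a b a≢b v≢a v≢b c₁ c₂ ne hv hr =
  inj₁ ((c₁ , c₂ , ne , (v , a , v≢a , hv a v≢a) ,
         (a , b , a≢b , hr a b a≢b (λ e → v≢a (sym e)) (λ e → v≢b (sym e))) , all) ,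
        v , c₁ , c₂ , ne , hv , hr)
  where
  all : ∀ i j → i ≢ j → (ψ i j ≡ c₁) ⊎ (ψ i j ≡ c₂)
  all i j i≢j with i ≟f v | j ≟f v
  ... | yes refl | _ = inj₁ (hv j i≢j)
  ... | no i≢v | yes refl = inj₁ (trans (sy i j i≢j) (hv i (λ e → i≢v (sym e))))
  ... | no i≢v | no j≢v = inj₂ (hr i j i≢j i≢v j≢v)

edgeSpecial : ∀ {n} (ψ : EdgeColoring n) → Symmetric ψ → (a b : Fin n) → a ≢ b → (c : Color) → ψ a b ≢ c →
  (x y : Fin n) → x ≢ y → ψ x y ≡ c →
  (∀ i j → i ≢ j → ¬ ((i ≡ a × j ≡ b) ⊎ (i ≡ b × j ≡ a)) → ψ i j ≡ c) → Special ψ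
edgeSpecial ψ sy a b a≢b c ne x y x≢y hxy h =
  inj₂ ((c , ψ a b , (λ e → ne (sym e)) , (x , y , x≢y , hxy) , (a , b , a≢b , refl) , all) ,
        a , b , c , a≢b , ne , h)
  where
  all : ∀ i j → i ≢ j → (ψ i j ≡ c) ⊎ (ψ i j ≡ ψ a b)
  all i j i≢j with (i ≟f a ×-dec j ≟f b) ⊎-dec (i ≟f b ×-dec j ≟f a)
  ... | yes (inj₁ (refl , refl)) = inj₂ refl
  ... | yes (inj₂ (refl , refl)) = inj₂ (sy b a (λ e → a≢b (sym e)))
  ... | no ¬e = inj₁ (h i j i≢j ¬e)

module Relabelled {n : ℕ} (σ : Relabelling n) (φ : EdgeColoring n) where
  private
    ψ : EdgeColoring n
    ψ = relabel σ φ

    pull : ∀ {i j x} → ψ (from σ i) (from σ j) ≡ x → φ i j ≡ x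
    pull {i} {j} e = subst₂ (λ a b → φ a b ≡ _) (to-from σ i) (to-from σ j) e

    from-≢ : ∀ {i j} → i ≢ j → from σ i ≢ from σ j
    from-≢ ne = ne ∘ from-injective σ

    to-≢ : ∀ {i j} → i ≢ j → to σ i ≢ to σ j
    to-≢ ne = ne ∘ to-injective σ

    from≡⇒ : ∀ {i x} → from σ i ≡ x → i ≡ to σ x
    from≡⇒ {i} e = trans (sym (to-from σ i)) (cong (to σ) e)

    usesTwo : UsesExactlyTwoColors ψ → UsesExactlyTwoColors φ
    usesTwo (c₁ , c₂ , ne , (a , b , ab , e₁) , (a′ , b′ , ab′ , e₂) , all) =
      c₁ , c₂ , ne , (to σ a , to σ b , to-≢ ab , e₁) , (to σ a′ , to σ b′ , to-≢ ab′ , e₂) ,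
      λ i j i≢j → Data.Sum.map pull pull (all (from σ i) (from σ j) (from-≢ i≢j))

  special : Special ψ → Special φ
  special (inj₁ (two , v , c₁ , c₂ , ne , hv , hr)) =
    inj₁ (usesTwo two , to σ v , c₁ , c₂ , ne ,
      (λ j v≢j → subst (λ z → φ (to σ v) z ≡ c₁) (to-from σ j)
                   (hv (from σ j) (λ e → v≢j (sym (from≡⇒ (sym e)))))) ,
      (λ i j i≢j i≢v j≢v → pull (hr (from σ i) (from σ j) (from-≢ i≢j) (i≢v ∘ from≡⇒) (j≢v ∘ from≡⇒))))
  special (inj₂ (two , a , b , c , ab , ne , h)) =
    inj₂ (usesTwo two , to σ a , to σ b , c , to-≢ ab , ne ,
      λ i j i≢j notAB → pull (h (from σ i) (from σ j) (from-≢ i≢j)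
        (λ { (inj₁ (ea , eb)) → notAB (inj₁ (from≡⇒ ea , from≡⇒ eb))
           ; (inj₂ (eb , ea)) → notAB (inj₂ (from≡⇒ eb , from≡⇒ ea)) })))

  nonMono : NonMonochromatic φ → NonMonochromatic ψ
  nonMono (a , b , c , d , ab , cd , ne) =
    from σ a , from σ b , from σ c , from σ d , from-≢ ab , from-≢ cd ,
    λ e → ne (trans (pull refl) (trans e (sym (pull refl))))

constant⇒¬nonMono : ∀ {n} (ψ : EdgeColoring n) (c : Color) → (∀ i j → i ≢ j → ψ i j ≡ c) → ¬ NonMonochromatic ψ
constant⇒¬nonMono ψ c h (a , b , c′ , d , ab , cd , ne) = ne (trans (h a b ab) (sym (h c′ d cd)))

count≡0⇒ : ∀ {m} (b : Fin m → Bool) → count b ≡ 0 → ∀ j → b j ≡ false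
count≡0⇒ {suc m} b e j with b zero in eb
count≡0⇒ {suc m} b e zero    | false = eb
count≡0⇒ {suc m} b e (suc j) | false = count≡0⇒ (b ∘ suc) e j

count≡1⇒ : ∀ {m} (b : Fin m → Bool) → count b ≡ 1 →
  Σ (Fin m) λ j → (b j ≡ true) × (∀ j′ → j′ ≢ j → b j′ ≡ false)
count≡1⇒ {suc m} b e with b zero in eb
... | true  = zero , eb , λ { zero ne → ⊥-elim (ne refl) ; (suc j′) _ → count≡0⇒ (b ∘ suc) (cong pred e) j′ }
... | false with count≡1⇒ (b ∘ suc) e
... | j , bj , rest = suc j , bj , λ { zero _ → eb ; (suc j′) ne → rest j′ (ne ∘ cong suc) }

hasType-intro : ∀ {m} α β (r s : Fin m → Color) j → r j ≡ α → s j ≡ β → hasType α β r s j ≡ true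
hasType-intro α β r s j refl refl rewrite ==c-refl (r j) | ==c-refl (s j) = refl

hasType-elim : ∀ {m} α β (r s : Fin m → Color) j → hasType α β r s j ≡ true → (r j ≡ α) × (s j ≡ β)
hasType-elim α β r s j e = ==c-true (proj₁ (∧-true e)) , ==c-true (proj₂ (∧-true e))

count≡0⇒¬hasType : ∀ {m} α β (r s : Fin m → Color) → count (hasType α β r s) ≡ 0 → ∀ j → r j ≡ α → s j ≡ β → ⊥
count≡0⇒¬hasType α β r s e j er es = true≢false (hasType-intro α β r s j er es) (count≡0⇒ _ e j)

module TwoApexShape {m : ℕ} (c e : Color) (r s : Fin m → Color) where
  F : EdgeColoring (suc (suc m))
  F = twoApex c e r s

  all-c : e ≡ c → (∀ j → r j ≡ c) → (∀ j → s j ≡ c) → ∀ i j → i ≢ j → F i j ≡ c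
  all-c ec hr hs zero zero ne = ⊥-elim (ne refl)
  all-c ec hr hs zero (suc zero) ne = ec
  all-c ec hr hs zero (suc (suc j)) ne = hr j
  all-c ec hr hs (suc zero) zero ne = ec
  all-c ec hr hs (suc zero) (suc zero) ne = ⊥-elim (ne refl)
  all-c ec hr hs (suc zero) (suc (suc j)) ne = hs j
  all-c ec hr hs (suc (suc i)) zero ne = hr i
  all-c ec hr hs (suc (suc i)) (suc zero) ne = hs i
  all-c ec hr hs (suc (suc i)) (suc (suc j)) ne = refl

  all-c-except-0k : e ≡ c → (∀ j → s j ≡ c) → (k : Fin m) → (∀ j → j ≢ k → r j ≡ c) →
    ∀ i j → i ≢ j → ¬ ((i ≡ zero × j ≡ suc (suc k)) ⊎ (i ≡ suc (suc k) × j ≡ zero)) → F i j ≡ c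
  all-c-except-0k ec hs k hr zero zero ne _ = ⊥-elim (ne refl)
  all-c-except-0k ec hs k hr zero (suc zero) ne _ = ec
  all-c-except-0k ec hs k hr zero (suc (suc j)) ne ned with j ≟f k
  ... | yes refl = ⊥-elim (ned (inj₁ (refl , refl)))
  ... | no jk = hr j jk
  all-c-except-0k ec hs k hr (suc zero) zero ne _ = ec
  all-c-except-0k ec hs k hr (suc zero) (suc zero) ne _ = ⊥-elim (ne refl)
  all-c-except-0k ec hs k hr (suc zero) (suc (suc j)) ne _ = hs j
  all-c-except-0k ec hs k hr (suc (suc i)) zero ne ned with i ≟f k
  ... | yes refl = ⊥-elim (ned (inj₂ (refl , refl)))
  ... | no ik = hr i ik
  all-c-except-0k ec hs k hr (suc (suc i)) (suc zero) ne _ = hs i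
  all-c-except-0k ec hs k hr (suc (suc i)) (suc (suc j)) ne _ = refl

  all-c-except-1k : e ≡ c → (∀ j → r j ≡ c) → (k : Fin m) → (∀ j → j ≢ k → s j ≡ c) →
    ∀ i j → i ≢ j → ¬ ((i ≡ suc zero × j ≡ suc (suc k)) ⊎ (i ≡ suc (suc k) × j ≡ suc zero)) → F i j ≡ c
  all-c-except-1k ec hr k hs zero zero ne _ = ⊥-elim (ne refl)
  all-c-except-1k ec hr k hs zero (suc zero) ne _ = ec
  all-c-except-1k ec hr k hs zero (suc (suc j)) ne _ = hr j
  all-c-except-1k ec hr k hs (suc zero) zero ne _ = ec
  all-c-except-1k ec hr k hs (suc zero) (suc zero) ne _ = ⊥-elim (ne refl)
  all-c-except-1k ec hr k hs (suc zero) (suc (suc j)) ne ned with j ≟f k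
  ... | yes refl = ⊥-elim (ned (inj₁ (refl , refl)))
  ... | no jk = hs j jk
  all-c-except-1k ec hr k hs (suc (suc i)) zero ne _ = hr i
  all-c-except-1k ec hr k hs (suc (suc i)) (suc zero) ne ned with i ≟f k
  ... | yes refl = ⊥-elim (ned (inj₂ (refl , refl)))
  ... | no ik = hs i ik
  all-c-except-1k ec hr k hs (suc (suc i)) (suc (suc j)) ne _ = refl

  all-c-except-01 : (∀ j → r j ≡ c) → (∀ j → s j ≡ c) →
    ∀ i j → i ≢ j → ¬ ((i ≡ zero × j ≡ suc zero) ⊎ (i ≡ suc zero × j ≡ zero)) → F i j ≡ c
  all-c-except-01 hr hs zero zero ne _ = ⊥-elim (ne refl)
  all-c-except-01 hr hs zero (suc zero) ne ned = ⊥-elim (ned (inj₁ (refl , refl)))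
  all-c-except-01 hr hs zero (suc (suc j)) ne _ = hr j
  all-c-except-01 hr hs (suc zero) zero ne ned = ⊥-elim (ned (inj₂ (refl , refl)))
  all-c-except-01 hr hs (suc zero) (suc zero) ne _ = ⊥-elim (ne refl)
  all-c-except-01 hr hs (suc zero) (suc (suc j)) ne _ = hs j
  all-c-except-01 hr hs (suc (suc i)) zero ne _ = hr i
  all-c-except-01 hr hs (suc (suc i)) (suc zero) ne _ = hs i
  all-c-except-01 hr hs (suc (suc i)) (suc (suc j)) ne _ = refl

  row₀ : ∀ {d} → e ≡ d → (∀ j → r j ≡ d) → ∀ j → zero ≢ j → F zero j ≡ d
  row₀ ed hr zero ne = ⊥-elim (ne refl)
  row₀ ed hr (suc zero) ne = ed
  row₀ ed hr (suc (suc j)) ne = hr j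
  off-0 : (∀ j → s j ≡ c) → ∀ i j → i ≢ j → i ≢ zero → j ≢ zero → F i j ≡ c
  off-0 hs zero j ne i0 j0 = ⊥-elim (i0 refl)
  off-0 hs (suc i) zero ne i0 j0 = ⊥-elim (j0 refl)
  off-0 hs (suc zero) (suc zero) ne i0 j0 = ⊥-elim (ne refl)
  off-0 hs (suc zero) (suc (suc j)) ne i0 j0 = hs j
  off-0 hs (suc (suc i)) (suc zero) ne i0 j0 = hs i
  off-0 hs (suc (suc i)) (suc (suc j)) ne i0 j0 = refl

  row₁ : ∀ {d} → e ≡ d → (∀ j → s j ≡ d) → ∀ j → suc zero ≢ j → F (suc zero) j ≡ d
  row₁ ed hs zero ne = ed
  row₁ ed hs (suc zero) ne = ⊥-elim (ne refl)
  row₁ ed hs (suc (suc j)) ne = hs j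
  off-1 : (∀ j → r j ≡ c) → ∀ i j → i ≢ j → i ≢ suc zero → j ≢ suc zero → F i j ≡ c
  off-1 hr zero zero ne i1 j1 = ⊥-elim (ne refl)
  off-1 hr zero (suc zero) ne i1 j1 = ⊥-elim (j1 refl)
  off-1 hr zero (suc (suc j)) ne i1 j1 = hr j
  off-1 hr (suc zero) j ne i1 j1 = ⊥-elim (i1 refl)
  off-1 hr (suc (suc i)) zero ne i1 j1 = hr i
  off-1 hr (suc (suc i)) (suc zero) ne i1 j1 = ⊥-elim (j1 refl)
  off-1 hr (suc (suc i)) (suc (suc j)) ne i1 j1 = refl

  all-d-except-base-pair : ∀ {d} → e ≡ d → (∀ j → r j ≡ d) → (∀ j → s j ≡ d) → (a b : Fin m) →
    (∀ i j → i ≢ j → (i ≡ a × j ≡ b) ⊎ (i ≡ b × j ≡ a)) →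
    ∀ i j → i ≢ j → ¬ ((i ≡ suc (suc a) × j ≡ suc (suc b)) ⊎ (i ≡ suc (suc b) × j ≡ suc (suc a))) → F i j ≡ d
  all-d-except-base-pair ed hr hs a b two zero zero ne _ = ⊥-elim (ne refl)
  all-d-except-base-pair ed hr hs a b two zero (suc zero) ne _ = ed
  all-d-except-base-pair ed hr hs a b two zero (suc (suc j)) ne _ = hr j
  all-d-except-base-pair ed hr hs a b two (suc zero) zero ne _ = ed
  all-d-except-base-pair ed hr hs a b two (suc zero) (suc zero) ne _ = ⊥-elim (ne refl)
  all-d-except-base-pair ed hr hs a b two (suc zero) (suc (suc j)) ne _ = hs j
  all-d-except-base-pair ed hr hs a b two (suc (suc i)) zero ne _ = hr i
  all-d-except-base-pair ed hr hs a b two (suc (suc i)) (suc zero) ne _ = hs i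
  all-d-except-base-pair ed hr hs a b two (suc (suc i)) (suc (suc j)) ne ned with two i j (λ e′ → ne (cong (λ z → suc (suc z)) e′))
  ... | inj₁ (refl , refl) = ⊥-elim (ned (inj₁ (refl , refl)))
  ... | inj₂ (refl , refl) = ⊥-elim (ned (inj₂ (refl , refl)))

  row-base : (k : Fin m) → r k ≡ c → s k ≡ c → ∀ j → suc (suc k) ≢ j → F (suc (suc k)) j ≡ c
  row-base k hr hs zero ne = hr
  row-base k hr hs (suc zero) ne = hs
  row-base k hr hs (suc (suc j)) ne = refl
  off-base : ∀ {d} → (k : Fin m) → e ≡ d → (∀ j → j ≢ k → r j ≡ d) → (∀ j → j ≢ k → s j ≡ d) →
    (∀ i j → i ≢ k → j ≢ k → i ≡ j) →
    ∀ i j → i ≢ j → i ≢ suc (suc k) → j ≢ suc (suc k) → F i j ≡ d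
  off-base k ed hr hs uq zero zero ne _ _ = ⊥-elim (ne refl)
  off-base k ed hr hs uq zero (suc zero) ne _ _ = ed
  off-base k ed hr hs uq zero (suc (suc j)) ne _ jk = hr j (λ e′ → jk (cong (λ z → suc (suc z)) e′))
  off-base k ed hr hs uq (suc zero) zero ne _ _ = ed
  off-base k ed hr hs uq (suc zero) (suc zero) ne _ _ = ⊥-elim (ne refl)
  off-base k ed hr hs uq (suc zero) (suc (suc j)) ne _ jk = hs j (λ e′ → jk (cong (λ z → suc (suc z)) e′))
  off-base k ed hr hs uq (suc (suc i)) zero ne ik _ = hr i (λ e′ → ik (cong (λ z → suc (suc z)) e′))
  off-base k ed hr hs uq (suc (suc i)) (suc zero) ne ik _ = hs i (λ e′ → ik (cong (λ z → suc (suc z)) e′))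
  off-base k ed hr hs uq (suc (suc i)) (suc (suc j)) ne ik jk =
    ⊥-elim (ne (cong (λ z → suc (suc z)) (uq i j (λ e′ → ik (cong (λ z → suc (suc z)) e′)) (λ e′ → jk (cong (λ z → suc (suc z)) e′)))))

Fin2-other-unique : ∀ {m′} → m′ ≡ 0 → (k i j : Fin (suc (suc m′))) → i ≢ k → j ≢ k → i ≡ j
Fin2-other-unique refl zero zero j ik jk = ⊥-elim (ik refl)
Fin2-other-unique refl zero (suc zero) zero ik jk = ⊥-elim (jk refl)
Fin2-other-unique refl zero (suc zero) (suc zero) ik jk = refl
Fin2-other-unique refl (suc zero) zero zero ik jk = refl
Fin2-other-unique refl (suc zero) zero (suc zero) ik jk = ⊥-elim (jk refl)
Fin2-other-unique refl (suc zero) (suc zero) j ik jk = ⊥-elim (ik refl)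

Fin2-pair : ∀ {m′} → m′ ≡ 0 → (i j : Fin (suc (suc m′))) → i ≢ j → (i ≡ zero × j ≡ suc zero) ⊎ (i ≡ suc zero × j ≡ zero)
Fin2-pair refl zero zero ne = ⊥-elim (ne refl)
Fin2-pair refl zero (suc zero) ne = inj₁ (refl , refl)
Fin2-pair refl (suc zero) zero ne = inj₂ (refl , refl)
Fin2-pair refl (suc zero) (suc zero) ne = ⊥-elim (ne refl)

sameOrOpp-RB : ∀ {c e} → IsRB c → IsRB e → (e ≡ c) ⊎ (e ≡ opp c)
sameOrOpp-RB isR isR = inj₁ refl
sameOrOpp-RB isR isB = inj₂ refl
sameOrOpp-RB isB isR = inj₂ refl
sameOrOpp-RB isB isB = inj₁ refl

opp≢ : ∀ {c} → IsRB c → opp c ≢ c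
opp≢ isR ()
opp≢ isB ()

module RowsFromCounts {m : ℕ} (c : Color) (r s : Fin m → Color)
                      (rr : ∀ j → SameOrOpp c (r j)) (rs : ∀ j → SameOrOpp c (s j)) where

  s≡c : #co c r s ≡ 0 → #oo c r s ≡ 0 → ∀ j → s j ≡ c
  s≡c q≡0 u≡0 j with rs j
  ... | inj₁ es = es
  ... | inj₂ es with rr j
  ... | inj₁ er = ⊥-elim (count≡0⇒¬hasType c (opp c) r s q≡0 j er es)
  ... | inj₂ er = ⊥-elim (count≡0⇒¬hasType (opp c) (opp c) r s u≡0 j er es)

  r≡c : #oc c r s ≡ 0 → #oo c r s ≡ 0 → ∀ j → r j ≡ c
  r≡c t≡0 u≡0 j with rr j
  ... | inj₁ er = er
  ... | inj₂ er with rs j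
  ... | inj₁ es = ⊥-elim (count≡0⇒¬hasType (opp c) c r s t≡0 j er es)
  ... | inj₂ es = ⊥-elim (count≡0⇒¬hasType (opp c) (opp c) r s u≡0 j er es)

  s≡opp : #cc c r s ≡ 0 → #oc c r s ≡ 0 → ∀ j → s j ≡ opp c
  s≡opp p≡0 t≡0 j with rs j
  ... | inj₂ es = es
  ... | inj₁ es with rr j
  ... | inj₁ er = ⊥-elim (count≡0⇒¬hasType c c r s p≡0 j er es)
  ... | inj₂ er = ⊥-elim (count≡0⇒¬hasType (opp c) c r s t≡0 j er es)

  r≡opp : #cc c r s ≡ 0 → #co c r s ≡ 0 → ∀ j → r j ≡ opp c
  r≡opp p≡0 q≡0 j with rr j
  ... | inj₂ er = er
  ... | inj₁ er with rs j
  ... | inj₁ es = ⊥-elim (count≡0⇒¬hasType c c r s p≡0 j er es)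
  ... | inj₂ es = ⊥-elim (count≡0⇒¬hasType c (opp c) r s q≡0 j er es)

IsTwoApex : ∀ {m} → EdgeColoring (suc (suc m)) → Color → Color → (Fin m → Color) → (Fin m → Color) → Set
IsTwoApex ψ c e r s = ∀ i j → i ≢ j → ψ i j ≡ twoApex c e r s i j

w≡wApex : ∀ {m} (ψ : EdgeColoring (suc (suc m))) → Symmetric ψ → RedBlue ψ → ∀ c e r s →
  IsTwoApex ψ c e r s → w ψ ≡ TwoApex.wApex c e r s
w≡wApex ψ sy rb c e r s shape =
  trans (w≡∑goodᵇ ψ sy rb) (∑-cong _ (λ f → cong 𝟙 (goodᵇ-cong ψ (twoApex c e r s) shape f f (λ _ → refl))))

module Exceptional {m′ : ℕ} (ψ : EdgeColoring (suc (suc (suc (suc m′))))) (sy : Symmetric ψ)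
                   (c e : Color) (r s : Fin (suc (suc m′)) → Color) (rc : IsRB c)
                   (rr : ∀ j → SameOrOpp c (r j)) (rs : ∀ j → SameOrOpp c (s j)) (shape : IsTwoApex ψ c e r s) where
  open TwoApexShape c e r s

  edge-0k : e ≡ c → (∀ j → s j ≡ c) → #oc c r s ≡ 1 → Special ψ
  edge-0k ec hs t≡1 with count≡1⇒ (hasType (opp c) c r s) t≡1
  ... | k , tk , rest = edgeSpecial ψ sy zero (suc (suc k)) (λ ()) c
    (λ e′ → opp≢ rc (trans (sym (proj₁ (hasType-elim (opp c) c r s k tk))) (trans (sym (shape zero (suc (suc k)) (λ ()))) e′)))
    zero (suc zero) (λ ()) (trans (shape zero (suc zero) (λ ())) ec)
    (λ i j ne ned → trans (shape i j ne) (all-c-except-0k ec hs k hr i j ne ned))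
    where
    hr : ∀ j → j ≢ k → r j ≡ c
    hr j jk with rr j
    ... | inj₁ er = er
    ... | inj₂ er = ⊥-elim (true≢false (hasType-intro (opp c) c r s j er (hs j)) (rest j jk))

  edge-1k : e ≡ c → (∀ j → r j ≡ c) → #co c r s ≡ 1 → Special ψ
  edge-1k ec hr q≡1 with count≡1⇒ (hasType c (opp c) r s) q≡1
  ... | k , tk , rest = edgeSpecial ψ sy (suc zero) (suc (suc k)) (λ ()) c
    (λ e′ → opp≢ rc (trans (sym (proj₂ (hasType-elim c (opp c) r s k tk))) (trans (sym (shape (suc zero) (suc (suc k)) (λ ()))) e′)))
    zero (suc zero) (λ ()) (trans (shape zero (suc zero) (λ ())) ec)
    (λ i j ne ned → trans (shape i j ne) (all-c-except-1k ec hr k hs i j ne ned))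
    where
    hs : ∀ j → j ≢ k → s j ≡ c
    hs j jk with rs j
    ... | inj₁ es = es
    ... | inj₂ es = ⊥-elim (true≢false (hasType-intro c (opp c) r s j (hr j) es) (rest j jk))

  edge-01 : e ≡ opp c → (∀ j → r j ≡ c) → (∀ j → s j ≡ c) → Special ψ
  edge-01 ecb hr hs = edgeSpecial ψ sy zero (suc zero) (λ ()) c
    (λ e′ → opp≢ rc (trans (sym ecb) (trans (sym (shape zero (suc zero) (λ ()))) e′)))
    zero (suc (suc zero)) (λ ()) (trans (shape zero (suc (suc zero)) (λ ())) (hr zero))
    (λ i j ne ned → trans (shape i j ne) (all-c-except-01 hr hs i j ne ned))

  edge-base : e ≡ opp c → (∀ j → r j ≡ opp c) → (∀ j → s j ≡ opp c) → m′ ≡ 0 → Special ψ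
  edge-base ecb hr hs m′≡0 = edgeSpecial ψ sy (suc (suc zero)) (suc (suc (suc zero))) (λ ()) (opp c)
    (λ e′ → opp≢ rc (sym (trans (sym (shape (suc (suc zero)) (suc (suc (suc zero))) (λ ()))) e′)))
    zero (suc zero) (λ ()) (trans (shape zero (suc zero) (λ ())) ecb)
    (λ i j ne ned → trans (shape i j ne) (all-d-except-base-pair ecb hr hs zero (suc zero) (Fin2-pair m′≡0) i j ne ned))

  vertex-base : e ≡ opp c → #cc c r s ≡ 1 → #co c r s ≡ 0 → #oc c r s ≡ 0 → m′ ≡ 0 → Special ψ
  vertex-base ecb p≡1 q≡0 t≡0 m′≡0 with count≡1⇒ (hasType c c r s) p≡1
  ... | k , tk , rest = vertexSpecial ψ sy (suc (suc k)) zero (suc zero) (λ ()) (λ ()) (λ ()) c (opp c)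
    (λ e′ → opp≢ rc (sym e′))
    (λ j ne → trans (shape _ _ ne) (row-base k (proj₁ (hasType-elim c c r s k tk)) (proj₂ (hasType-elim c c r s k tk)) j ne))
    (λ i j ne ik jk → trans (shape i j ne)
       (off-base k ecb (λ j jk → proj₁ (others j jk)) (λ j jk → proj₂ (others j jk)) (Fin2-other-unique m′≡0 k) i j ne ik jk))
    where
    others : ∀ j → j ≢ k → (r j ≡ opp c) × (s j ≡ opp c)
    others j jk with rr j | rs j
    ... | inj₁ er | inj₁ es = ⊥-elim (true≢false (hasType-intro c c r s j er es) (rest j jk))
    ... | inj₁ er | inj₂ es = ⊥-elim (count≡0⇒¬hasType c (opp c) r s q≡0 j er es)
    ... | inj₂ er | inj₁ es = ⊥-elim (count≡0⇒¬hasType (opp c) c r s t≡0 j er es)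
    ... | inj₂ er | inj₂ es = er , es

  vertex-0 : e ≡ opp c → (∀ j → r j ≡ opp c) → (∀ j → s j ≡ c) → Special ψ
  vertex-0 ecb hr hs = vertexSpecial ψ sy zero (suc zero) (suc (suc zero)) (λ ()) (λ ()) (λ ()) (opp c) c (opp≢ rc)
    (λ j ne → trans (shape zero j ne) (row₀ ecb hr j ne))
    (λ i j ne i0 j0 → trans (shape i j ne) (off-0 hs i j ne i0 j0))

  vertex-1 : e ≡ opp c → (∀ j → r j ≡ c) → (∀ j → s j ≡ opp c) → Special ψ
  vertex-1 ecb hr hs = vertexSpecial ψ sy (suc zero) zero (suc (suc zero)) (λ ()) (λ ()) (λ ()) (opp c) c (opp≢ rc)
    (λ j ne → trans (shape (suc zero) j ne) (row₁ ecb hs j ne))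
    (λ i j ne i1 j1 → trans (shape i j ne) (off-1 hr i j ne i1 j1))

  monochromatic : e ≡ c → (∀ j → r j ≡ c) → (∀ j → s j ≡ c) → ¬ NonMonochromatic ψ
  monochromatic ec hr hs = constant⇒¬nonMono ψ c (λ i j ne → trans (shape i j ne) (all-c ec hr hs i j ne))

twoApex-bound : ∀ {m′} (ψ : EdgeColoring (suc (suc (suc (suc m′))))) → Symmetric ψ → RedBlue ψ →
  (c e : Color) (r s : Fin (suc (suc m′)) → Color) → IsRB c → IsRB e →
  (∀ j → SameOrOpp c (r j)) → (∀ j → SameOrOpp c (s j)) →
  IsTwoApex ψ c e r s → ¬ Special ψ → NonMonochromatic ψ → w ψ + 1 ≤ 6 * 2 ^ (suc (suc m′))
twoApex-bound {m′} ψ sy rb c e r s rc re rr rs shape nsp nm = byEdge (sameOrOpp-RB rc re)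
  where
  open ApexCount c e r s rc rr rs using (p; q; t; u; wApex-closedForm)
  open RowsFromCounts c r s rr rs
  open Exceptional ψ sy c e r s rc rr rs shape

  size : p + q + t + u ≡ suc (suc m′)
  size = #types-sum rc r s rr rs

  2≤size : 2 ≤ p + q + t + u
  2≤size = subst (2 ≤_) (sym size) (s≤s (s≤s z≤n))

  m′≡0 : ∀ {a b d f} → p ≡ a → q ≡ b → t ≡ d → u ≡ f → a + b + d + f ≡ 2 → m′ ≡ 0
  m′≡0 refl refl refl refl e = cong (pred ∘ pred) (trans (sym size) e)

  2^size : 2 ^ p * 2 ^ q * 2 ^ t * 2 ^ u ≡ 2 ^ suc (suc m′)
  2^size = begin
    2 ^ p * 2 ^ q * 2 ^ t * 2 ^ u  ≡⟨ cong (λ z → z * 2 ^ t * 2 ^ u) (^-distribˡ-+-* 2 p q) ⟨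
    2 ^ (p + q) * 2 ^ t * 2 ^ u    ≡⟨ cong (_* 2 ^ u) (^-distribˡ-+-* 2 (p + q) t) ⟨
    2 ^ (p + q + t) * 2 ^ u        ≡⟨ ^-distribˡ-+-* 2 (p + q + t) u ⟨
    2 ^ (p + q + t + u)            ≡⟨ cong (2 ^_) size ⟩
    2 ^ suc (suc m′)               ∎
    where open ≡-Reasoning

  Goal : Set
  Goal = w ψ + 1 ≤ 6 * 2 ^ suc (suc m′)

  bound : w ψ + 1 ≤ 6 * (2 ^ p * 2 ^ q * 2 ^ t * 2 ^ u) → Goal
  bound = subst (λ z → w ψ + 1 ≤ 6 * z) 2^size

  w-closed : ∀ {R} → TwoApex.wApex c e r s + correction (0 ^ q) (0 ^ t) (0 ^ u) ≡ R →
    w ψ + correction (0 ^ q) (0 ^ t) (0 ^ u) ≡ R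
  w-closed = trans (cong (_+ correction (0 ^ q) (0 ^ t) (0 ^ u)) (w≡wApex ψ sy rb c e r s shape))

  fromSame : e ≡ c → BoundSame p q t u (w ψ) → Goal
  fromSame ec (inj₁ b) = bound b
  fromSame ec (inj₂ (inj₁ (q≡0 , t≡0 , u≡0)))         = ⊥-elim (monochromatic ec (r≡c t≡0 u≡0) (s≡c q≡0 u≡0) nm)
  fromSame ec (inj₂ (inj₂ (inj₁ (q≡0 , u≡0 , t≡1))))  = ⊥-elim (nsp (edge-0k ec (s≡c q≡0 u≡0) t≡1))
  fromSame ec (inj₂ (inj₂ (inj₂ (t≡0 , u≡0 , q≡1))))  = ⊥-elim (nsp (edge-1k ec (r≡c t≡0 u≡0) q≡1))

  fromOpp : e ≡ opp c → BoundOpp p q t u (w ψ) → Goal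
  fromOpp ecb (inj₁ b) = bound b
  fromOpp ecb (inj₂ (inj₁ (q≡0 , t≡0 , u≡0))) = ⊥-elim (nsp (edge-01 ecb (r≡c t≡0 u≡0) (s≡c q≡0 u≡0)))
  fromOpp ecb (inj₂ (inj₂ (inj₁ (p≡0 , q≡0 , t≡0 , u≡2)))) =
    ⊥-elim (nsp (edge-base ecb (r≡opp p≡0 q≡0) (s≡opp p≡0 t≡0) (m′≡0 p≡0 q≡0 t≡0 u≡2 refl)))
  fromOpp ecb (inj₂ (inj₂ (inj₂ (inj₁ (p≡1 , q≡0 , t≡0 , u≡1))))) =
    ⊥-elim (nsp (vertex-base ecb p≡1 q≡0 t≡0 (m′≡0 p≡1 q≡0 t≡0 u≡1 refl)))
  fromOpp ecb (inj₂ (inj₂ (inj₂ (inj₂ (inj₁ (p≡0 , q≡0 , u≡0)))))) =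
    ⊥-elim (nsp (vertex-0 ecb (r≡opp p≡0 q≡0) (s≡c q≡0 u≡0)))
  fromOpp ecb (inj₂ (inj₂ (inj₂ (inj₂ (inj₂ (p≡0 , t≡0 , u≡0)))))) =
    ⊥-elim (nsp (vertex-1 ecb (r≡c t≡0 u≡0) (s≡opp p≡0 t≡0)))

  byEdge : (e ≡ c) ⊎ (e ≡ opp c) → Goal
  byEdge (inj₁ ec)  = fromSame ec  (closedSame⇒bound p q t u (w ψ) 2≤size (w-closed (proj₁ (wApex-closedForm re) ec)))
  byEdge (inj₂ ecb) = fromOpp  ecb (closedOpp⇒bound p q t u (w ψ) 2≤size
                                      (w-closed (proj₂ (wApex-closedForm re) (λ ec → opp≢ rc (trans (sym ecb) ec)))))

twoApex-of : ∀ {m} (φ : EdgeColoring (suc (suc m))) → Symmetric φ → (c : Color) →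
  (∀ i j → i ≢ j → φ (suc (suc i)) (suc (suc j)) ≡ c) →
  ∀ i j → i ≢ j → φ i j ≡ twoApex c (φ zero (suc zero)) (λ j → φ zero (suc (suc j))) (λ j → φ (suc zero) (suc (suc j))) i j
twoApex-of φ sy c h zero zero ne = ⊥-elim (ne refl)
twoApex-of φ sy c h zero (suc zero) ne = refl
twoApex-of φ sy c h zero (suc (suc j)) ne = refl
twoApex-of φ sy c h (suc zero) zero ne = sy _ _ ne
twoApex-of φ sy c h (suc zero) (suc zero) ne = ⊥-elim (ne refl)
twoApex-of φ sy c h (suc zero) (suc (suc j)) ne = refl
twoApex-of φ sy c h (suc (suc i)) zero ne = sy _ _ ne
twoApex-of φ sy c h (suc (suc i)) (suc zero) ne = sy _ _ ne
twoApex-of φ sy c h (suc (suc i)) (suc (suc j)) ne = h i j (λ e → ne (cong (λ z → suc (suc z)) e))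


-- Reduction to two-apex colourings and the induction

isRB : ∀ {x} → (x ≡ red ⊎ x ≡ blue) → IsRB x
isRB (inj₁ refl) = isR
isRB (inj₂ refl) = isB

isRB-at : ∀ {n} (φ : EdgeColoring n) → RedBlue φ → ∀ {x} a b → a ≢ b → φ a b ≡ x → IsRB x
isRB-at φ rb a b ab e = isRB (subst (λ z → (z ≡ red) ⊎ (z ≡ blue)) e (rb a b ab))

sameOrOpp : ∀ {c x} → IsRB c → (x ≡ red ⊎ x ≡ blue) → SameOrOpp c x
sameOrOpp isR (inj₁ e) = inj₁ e
sameOrOpp isR (inj₂ e) = inj₂ e
sameOrOpp isB (inj₁ e) = inj₂ e
sameOrOpp isB (inj₂ e) = inj₁ e

w+1≤-monochromaticBase : ∀ k (ψ : EdgeColoring (suc (suc (suc (suc k))))) → Symmetric ψ → RedBlue ψ →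
  ¬ Special ψ → NonMonochromatic ψ → (c : Color) →
  (∀ i j → i ≢ j → ψ (suc (suc i)) (suc (suc j)) ≡ c) → w ψ + 1 ≤ 6 * 2 ^ (suc (suc k))
w+1≤-monochromaticBase k ψ sy rb nsp nm c h =
  twoApex-bound ψ sy rb c (ψ zero (suc zero)) (λ j → ψ zero (suc (suc j))) (λ j → ψ (suc zero) (suc (suc j)))
    rc (isRB (rb zero (suc zero) (λ ()))) (λ j → sameOrOpp rc (rb zero (suc (suc j)) (λ ())))
    (λ j → sameOrOpp rc (rb (suc zero) (suc (suc j)) (λ ())))
    (twoApex-of ψ sy c h) nsp nm
  where
  rc : IsRB c
  rc = isRB-at ψ rb (suc (suc zero)) (suc (suc (suc zero))) (λ ()) (h zero (suc zero) (λ ()))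

¬nonMono⇒constant : ∀ {n} (φ : EdgeColoring n) → ¬ NonMonochromatic φ → ∀ a b c d → a ≢ b → c ≢ d → φ a b ≡ φ c d
¬nonMono⇒constant φ nnm a b c d ab cd with φ a b ≟c φ c d
... | yes e = e
... | no ne = ⊥-elim (nnm (a , b , c , d , ab , cd , ne))

pattern f0 = zero
pattern f1 = suc zero
pattern f2 = suc (suc zero)

triangle : Color → Color → Color → Fin 3 → Fin 3 → Color
triangle x y z f0 f1 = x
triangle x y z f1 f0 = x
triangle x y z f0 f2 = y
triangle x y z f2 f0 = y
triangle x y z f1 f2 = z
triangle x y z f2 f1 = z
triangle x y z f0 f0 = red
triangle x y z f1 f1 = red
triangle x y z f2 f2 = red

triangle-of : (φ : EdgeColoring 3) → Symmetric φ → ∀ i j → i ≢ j → φ i j ≡ triangle (φ f0 f1) (φ f0 f2) (φ f1 f2) i j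
triangle-of φ sy f0 f0 ne = ⊥-elim (ne refl)
triangle-of φ sy f0 f1 ne = refl
triangle-of φ sy f0 f2 ne = refl
triangle-of φ sy f1 f0 ne = sy _ _ ne
triangle-of φ sy f1 f1 ne = ⊥-elim (ne refl)
triangle-of φ sy f1 f2 ne = refl
triangle-of φ sy f2 f0 ne = sy _ _ ne
triangle-of φ sy f2 f1 ne = sy _ _ ne
triangle-of φ sy f2 f2 ne = ⊥-elim (ne refl)

triangle-row₀ : ∀ {x z} j → f0 ≢ j → triangle x x z f0 j ≡ x
triangle-row₀ f0 ne = ⊥-elim (ne refl)
triangle-row₀ f1 ne = refl
triangle-row₀ f2 ne = refl
triangle-off₀ : ∀ {x z} i j → i ≢ j → i ≢ f0 → j ≢ f0 → triangle x x z i j ≡ z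
triangle-off₀ f0 j _ a _ = ⊥-elim (a refl)
triangle-off₀ f1 f0 _ _ b = ⊥-elim (b refl)
triangle-off₀ f1 f1 ne _ _ = ⊥-elim (ne refl)
triangle-off₀ f1 f2 _ _ _ = refl
triangle-off₀ f2 f0 _ _ b = ⊥-elim (b refl)
triangle-off₀ f2 f1 _ _ _ = refl
triangle-off₀ f2 f2 ne _ _ = ⊥-elim (ne refl)
triangle-row₁ : ∀ {x y} j → f1 ≢ j → triangle x y x f1 j ≡ x
triangle-row₁ f0 ne = refl
triangle-row₁ f1 ne = ⊥-elim (ne refl)
triangle-row₁ f2 ne = refl
triangle-off₁ : ∀ {x y} i j → i ≢ j → i ≢ f1 → j ≢ f1 → triangle x y x i j ≡ y
triangle-off₁ f0 f0 ne _ _ = ⊥-elim (ne refl)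
triangle-off₁ f0 f1 _ _ b = ⊥-elim (b refl)
triangle-off₁ f0 f2 _ _ _ = refl
triangle-off₁ f1 j _ a _ = ⊥-elim (a refl)
triangle-off₁ f2 f0 _ _ _ = refl
triangle-off₁ f2 f1 _ _ b = ⊥-elim (b refl)
triangle-off₁ f2 f2 ne _ _ = ⊥-elim (ne refl)
triangle-row₂ : ∀ {x y} j → f2 ≢ j → triangle x y y f2 j ≡ y
triangle-row₂ f0 ne = refl
triangle-row₂ f1 ne = refl
triangle-row₂ f2 ne = ⊥-elim (ne refl)
triangle-off₂ : ∀ {x y} i j → i ≢ j → i ≢ f2 → j ≢ f2 → triangle x y y i j ≡ x
triangle-off₂ f0 f0 ne _ _ = ⊥-elim (ne refl)
triangle-off₂ f0 f1 _ _ _ = refl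
triangle-off₂ f0 f2 _ _ b = ⊥-elim (b refl)
triangle-off₂ f1 f0 _ _ _ = refl
triangle-off₂ f1 f1 ne _ _ = ⊥-elim (ne refl)
triangle-off₂ f1 f2 _ _ b = ⊥-elim (b refl)
triangle-off₂ f2 j _ a _ = ⊥-elim (a refl)
triangle-constant : ∀ {x} i j → i ≢ j → triangle x x x i j ≡ x
triangle-constant f0 f0 ne = ⊥-elim (ne refl)
triangle-constant f0 f1 ne = refl
triangle-constant f0 f2 ne = refl
triangle-constant f1 f0 ne = refl
triangle-constant f1 f1 ne = ⊥-elim (ne refl)
triangle-constant f1 f2 ne = refl
triangle-constant f2 f0 ne = refl
triangle-constant f2 f1 ne = refl
triangle-constant f2 f2 ne = ⊥-elim (ne refl)

K₃-special-by-colours : (φ : EdgeColoring 3) → Symmetric φ → ∀ x y z → φ f0 f1 ≡ x → φ f0 f2 ≡ y → φ f1 f2 ≡ z →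
  IsRB x → IsRB y → IsRB z → NonMonochromatic φ → ¬ Special φ → ⊥
K₃-special-by-colours φ sy x y z refl refl refl rx ry rz nm nsp = go rx ry rz
  where
  φT : ∀ i j → i ≢ j → φ i j ≡ triangle (φ f0 f1) (φ f0 f2) (φ f1 f2) i j
  φT = triangle-of φ sy
  go : IsRB (φ f0 f1) → IsRB (φ f0 f2) → IsRB (φ f1 f2) → ⊥
  go rx ry rz with φ f0 f1 | φ f0 f2 | φ f1 f2 | φT
  go isR isR isR | .red | .red | .red | φT′ = constant⇒¬nonMono φ red (λ i j ne → trans (φT′ i j ne) (triangle-constant i j ne)) nm
  go isB isB isB | .blue | .blue | .blue | φT′ = constant⇒¬nonMono φ blue (λ i j ne → trans (φT′ i j ne) (triangle-constant i j ne)) nm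
  go isR isR isB | .red | .red | .blue | φT′ = nsp (vertexSpecial φ sy f0 f1 f2 (λ ()) (λ ()) (λ ()) red blue (λ ())
    (λ j ne → trans (φT′ f0 j ne) (triangle-row₀ j ne)) (λ i j ne a b → trans (φT′ i j ne) (triangle-off₀ i j ne a b)))
  go isB isB isR | .blue | .blue | .red | φT′ = nsp (vertexSpecial φ sy f0 f1 f2 (λ ()) (λ ()) (λ ()) blue red (λ ())
    (λ j ne → trans (φT′ f0 j ne) (triangle-row₀ j ne)) (λ i j ne a b → trans (φT′ i j ne) (triangle-off₀ i j ne a b)))
  go isR isB isR | .red | .blue | .red | φT′ = nsp (vertexSpecial φ sy f1 f0 f2 (λ ()) (λ ()) (λ ()) red blue (λ ())
    (λ j ne → trans (φT′ f1 j ne) (triangle-row₁ j ne)) (λ i j ne a b → trans (φT′ i j ne) (triangle-off₁ i j ne a b)))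
  go isB isR isB | .blue | .red | .blue | φT′ = nsp (vertexSpecial φ sy f1 f0 f2 (λ ()) (λ ()) (λ ()) blue red (λ ())
    (λ j ne → trans (φT′ f1 j ne) (triangle-row₁ j ne)) (λ i j ne a b → trans (φT′ i j ne) (triangle-off₁ i j ne a b)))
  go isR isB isB | .red | .blue | .blue | φT′ = nsp (vertexSpecial φ sy f2 f0 f1 (λ ()) (λ ()) (λ ()) blue red (λ ())
    (λ j ne → trans (φT′ f2 j ne) (triangle-row₂ j ne)) (λ i j ne a b → trans (φT′ i j ne) (triangle-off₂ i j ne a b)))
  go isB isR isR | .blue | .red | .red | φT′ = nsp (vertexSpecial φ sy f2 f0 f1 (λ ()) (λ ()) (λ ()) red blue (λ ())
    (λ j ne → trans (φT′ f2 j ne) (triangle-row₂ j ne)) (λ i j ne a b → trans (φT′ i j ne) (triangle-off₂ i j ne a b)))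

K₃-special : (φ : EdgeColoring 3) → Symmetric φ → RedBlue φ → NonMonochromatic φ → ¬ Special φ → ⊥
K₃-special φ sy rb nm nsp = K₃-special-by-colours φ sy _ _ _ refl refl refl (isRB (rb f0 f1 (λ ()))) (isRB (rb f0 f2 (λ ()))) (isRB (rb f1 f2 (λ ()))) nm nsp

≤2*+1-< : ∀ a b X → a ≤ 2 * b + 1 → b < 3 * X → a < 3 * (2 * X)
≤2*+1-< a b X a≤ b< = ≤-trans (s≤s a≤) (≤-trans (≤-reflexive (double b)) (≤-trans (*-monoʳ-≤ 2 b<) (≤-reflexive (swap X))))
  where
  double : ∀ b → suc (2 * b + 1) ≡ 2 * suc b
  double = solve-∀
  swap : ∀ X → 2 * (3 * X) ≡ 3 * (2 * X)
  swap = solve-∀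

+1≤6*⇒< : ∀ a X → a + 1 ≤ 6 * X → a < 3 * (2 * X)
+1≤6*⇒< a X h = subst₂ _≤_ (+-comm a 1) (*-assoc 3 2 X) h

to-suc≢to-zero : ∀ {n} (σ : Relabelling (suc n)) {v} → to σ zero ≡ v → ∀ i → to σ (suc i) ≢ v
to-suc≢to-zero σ σ₀ i e with to-injective σ (trans e (sym σ₀))
... | ()

module NonSpecialStep {k : ℕ} (φ : EdgeColoring (suc (suc (suc (suc k))))) (sy : Symmetric φ) (rb : RedBlue φ)
                      (nm : NonMonochromatic φ) (nsp : ¬ Special φ) where
  Goal : Set
  Goal = w φ < 3 * 2 ^ suc (suc (suc k))

  via-relabel : (σ : Relabelling (suc (suc (suc (suc k))))) (c : Color) →
    (∀ i j → i ≢ j → relabel σ φ (suc (suc i)) (suc (suc j)) ≡ c) → Goal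
  via-relabel σ c h = subst (_< 3 * 2 ^ suc (suc (suc k))) {x = w (relabel σ φ)} {y = w φ} (w-relabel σ φ sy rb)
    (+1≤6*⇒< (w (relabel σ φ)) (2 ^ suc (suc k))
      (w+1≤-monochromaticBase k (relabel σ φ) (relabel-symmetric σ φ sy) (relabel-redBlue σ φ rb)
        (λ sp → nsp (Relabelled.special σ φ sp)) (Relabelled.nonMono σ φ nm) c h))

  via-restrict : w (restrict φ) < 3 * 2 ^ suc (suc k) → Goal
  via-restrict = ≤2*+1-< (w φ) (w (restrict φ)) (2 ^ suc (suc k)) (w-restrict-≤ φ sy rb)

  via-monochromatic : ¬ NonMonochromatic (restrict φ) → Goal
  via-monochromatic nnm = via-relabel idᴿ (φ (suc zero) (suc (suc zero))) λ i j ne →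
    ¬nonMono⇒constant (restrict φ) nnm (suc i) (suc j) zero (suc zero) (ne ∘ suc-injective) (λ ())

  via-vertexSpecial : VertexSpecial (restrict φ) → Goal
  via-vertexSpecial (_ , v , _ , c₂ , _ , _ , hr) = via-relabel (liftᴿ σ) c₂ λ i j ne →
    hr (to σ (suc i)) (to σ (suc j)) (λ e → ne (suc-injective (to-injective σ e)))
       (to-suc≢to-zero σ (sending₀-zero v) i) (to-suc≢to-zero σ (sending₀-zero v) j)
    where
    σ : Relabelling (suc (suc (suc k)))
    σ = sending₀ v

  via-edgeSpecial : EdgeSpecial (restrict φ) → Goal
  via-edgeSpecial (_ , a , b , c , a≢b , _ , h) = via-pair (sending₀₁ a b a≢b)
    where
    via-pair : Σ (Relabelling (suc (suc (suc k)))) (λ σ → (to σ zero ≡ a) × (to σ (suc zero) ≡ b)) → Goal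
    via-pair (σ , σ₀ , _) = via-relabel (liftᴿ σ) c λ i j ne →
      h (to σ (suc i)) (to σ (suc j)) (λ e → ne (suc-injective (to-injective σ e)))
        λ { (inj₁ (e , _)) → to-suc≢to-zero σ σ₀ i e ; (inj₂ (_ , e)) → to-suc≢to-zero σ σ₀ j e }

  -- The special vertex, or an endpoint of the special edge, of the restriction is moved to
  -- vertex 1, so that the vertices from 2 on span a monochromatic clique.
  via-special : Special (restrict φ) → Goal
  via-special (inj₁ vs) = via-vertexSpecial vs
  via-special (inj₂ es) = via-edgeSpecial es

w<-nonSpecial : ∀ k (φ : EdgeColoring (suc (suc (suc k)))) → Symmetric φ → RedBlue φ →
  NonMonochromatic φ → ¬ Special φ → w φ < 3 * 2 ^ suc (suc k)
w<-nonSpecial zero    φ sy rb nm nsp = ⊥-elim (K₃-special φ sy rb nm nsp)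
-- The goal is decidable, so the case split on the restriction may be classical.
w<-nonSpecial (suc k) φ sy rb nm nsp = decidable-stable (w φ <? 3 * 2 ^ suc (suc (suc k))) λ ¬goal →
  ¬¬-excluded-middle λ
    { (no nnm)  → ¬goal (via-monochromatic nnm)
    ; (yes nm′) → ¬¬-excluded-middle λ
        { (yes sp′) → ¬goal (via-special sp′)
        ; (no nsp′) → ¬goal (via-restrict (w<-nonSpecial k (restrict φ) (restrict-symmetric φ sy)
                                                          (restrict-redBlue φ rb) nm′ nsp′)) } }
  where open NonSpecialStep φ sy rb nm nsp


-- Exact values for special colourings

count-false : ∀ {m} (b : Fin m → Bool) → (∀ j → b j ≡ false) → count b ≡ 0
count-false {zero}  b h = refl
count-false {suc m} b h rewrite h zero = count-false (b ∘ suc) (h ∘ suc)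

count-true : ∀ {m} (b : Fin m → Bool) → (∀ j → b j ≡ true) → count b ≡ m
count-true {zero}  b h = refl
count-true {suc m} b h rewrite h zero = cong suc (count-true (b ∘ suc) (h ∘ suc))

closedOpp-vertexSpecial : ∀ W p q t u k → p ≡ 0 → q ≡ 0 → t ≡ suc k → u ≡ 0 →
  W + correction (0 ^ q) (0 ^ t) (0 ^ u) ≡ closedOpp (2 ^ p) (2 ^ q) (2 ^ t) (2 ^ u) (0 ^ q) (0 ^ t) (0 ^ u) →
  W ≡ 3 * 2 ^ suc (suc k) + 1
closedOpp-vertexSpecial W .0 .0 .(suc k) .0 k refl refl refl refl h = +-cancelʳ-≡ 3 W _ (trans h (identity (2 ^ suc k)))
  where
  identity : ∀ T → 4 * (1 * 1 * T * 1) + 2 * 1 + 1 + T + 1 + 1 * 0 + T * 1 + 1 * 0 ≡ 3 * (2 * T) + 1 + 3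
  identity = solve-∀

closedOpp-edgeSpecial : ∀ W p q t u k → p ≡ suc k → q ≡ 0 → t ≡ 0 → u ≡ 0 →
  W + correction (0 ^ q) (0 ^ t) (0 ^ u) ≡ closedOpp (2 ^ p) (2 ^ q) (2 ^ t) (2 ^ u) (0 ^ q) (0 ^ t) (0 ^ u) →
  W ≡ 3 * 2 ^ suc (suc k) + 1
closedOpp-edgeSpecial W .(suc k) .0 .0 .0 k refl refl refl refl h = +-cancelʳ-≡ 5 W _ (trans h (identity (2 ^ suc k)))
  where
  identity : ∀ T → 4 * (T * 1 * 1 * 1) + 2 * T + 1 + 1 + 1 + 1 * 1 + 1 * 1 + 1 * 1 ≡ 3 * (2 * T) + 1 + 5
  identity = solve-∀

opp-IsRB : ∀ {c} → IsRB c → IsRB (opp c)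
opp-IsRB isR = isB
opp-IsRB isB = isR

wApex-vertexSpecial : ∀ k {c} → IsRB c → TwoApex.wApex {suc k} c (opp c) (λ _ → opp c) (λ _ → c) ≡ 3 * 2 ^ suc (suc k) + 1
wApex-vertexSpecial k {c} rc = closedOpp-vertexSpecial _ p q t u k
  (count-false {suc k} _ λ _ → cong (_∧ (c ==c c)) (opp==c rc))
  (count-false {suc k} _ λ _ → cong (_∧ (c ==c opp c)) (opp==c rc))
  (count-true  {suc k} _ λ _ → cong₂ _∧_ (==c-refl (opp c)) (==c-refl c))
  (count-false {suc k} _ λ _ → trans (cong ((opp c ==c opp c) ∧_) (==c-opp rc)) (∧-zeroʳ _))
  (proj₂ (wApex-closedForm (opp-IsRB rc)) (opp≢ rc))
  where open ApexCount {suc k} c (opp c) (λ _ → opp c) (λ _ → c) rc (λ _ → inj₂ refl) (λ _ → inj₁ refl)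

wApex-edgeSpecial : ∀ k {c} → IsRB c → TwoApex.wApex {suc k} c (opp c) (λ _ → c) (λ _ → c) ≡ 3 * 2 ^ suc (suc k) + 1
wApex-edgeSpecial k {c} rc = closedOpp-edgeSpecial _ p q t u k
  (count-true  {suc k} _ λ _ → cong₂ _∧_ (==c-refl c) (==c-refl c))
  (count-false {suc k} _ λ _ → trans (cong ((c ==c c) ∧_) (==c-opp rc)) (∧-zeroʳ _))
  (count-false {suc k} _ λ _ → cong (_∧ (c ==c c)) (==c-opp rc))
  (count-false {suc k} _ λ _ → cong (_∧ (c ==c opp c)) (==c-opp rc))
  (proj₂ (wApex-closedForm (opp-IsRB rc)) (opp≢ rc))
  where open ApexCount {suc k} c (opp c) (λ _ → c) (λ _ → c) rc (λ _ → inj₁ refl) (λ _ → inj₁ refl)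

vertexSpecial-shape : ∀ {m} (χ : EdgeColoring (suc (suc m))) (a b : Color) → (∀ j → zero ≢ j → χ zero j ≡ a) →
  (∀ i → i ≢ zero → χ i zero ≡ a) → (∀ i j → i ≢ j → i ≢ zero → j ≢ zero → χ i j ≡ b) →
  IsTwoApex χ b a (λ _ → a) (λ _ → b)
vertexSpecial-shape χ a b h0 h0′ hr zero zero ne = ⊥-elim (ne refl)
vertexSpecial-shape χ a b h0 h0′ hr zero (suc zero) ne = h0 _ ne
vertexSpecial-shape χ a b h0 h0′ hr zero (suc (suc j)) ne = h0 _ ne
vertexSpecial-shape χ a b h0 h0′ hr (suc zero) zero ne = h0′ (suc zero) ne
vertexSpecial-shape χ a b h0 h0′ hr (suc zero) (suc zero) ne = ⊥-elim (ne refl)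
vertexSpecial-shape χ a b h0 h0′ hr (suc zero) (suc (suc j)) ne = hr _ _ ne (λ ()) (λ ())
vertexSpecial-shape χ a b h0 h0′ hr (suc (suc i)) zero ne = h0′ _ ne
vertexSpecial-shape χ a b h0 h0′ hr (suc (suc i)) (suc zero) ne = hr _ _ ne (λ ()) (λ ())
vertexSpecial-shape χ a b h0 h0′ hr (suc (suc i)) (suc (suc j)) ne = hr _ _ ne (λ ()) (λ ())

edgeSpecial-shape : ∀ {m} (χ : EdgeColoring (suc (suc m))) (d c : Color) → χ zero (suc zero) ≡ d → χ (suc zero) zero ≡ d →
  (∀ i j → i ≢ j → ¬ ((i ≡ zero × j ≡ suc zero) ⊎ (i ≡ suc zero × j ≡ zero)) → χ i j ≡ c) →
  IsTwoApex χ c d (λ _ → c) (λ _ → c)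
edgeSpecial-shape χ d c e01 e10 h zero zero ne = ⊥-elim (ne refl)
edgeSpecial-shape χ d c e01 e10 h zero (suc zero) ne = e01
edgeSpecial-shape χ d c e01 e10 h zero (suc (suc j)) ne = h _ _ ne (λ { (inj₁ (_ , ())) ; (inj₂ (() , _)) })
edgeSpecial-shape χ d c e01 e10 h (suc zero) zero ne = e10
edgeSpecial-shape χ d c e01 e10 h (suc zero) (suc zero) ne = ⊥-elim (ne refl)
edgeSpecial-shape χ d c e01 e10 h (suc zero) (suc (suc j)) ne = h _ _ ne (λ { (inj₁ (() , _)) ; (inj₂ (_ , ())) })
edgeSpecial-shape χ d c e01 e10 h (suc (suc i)) zero ne = h _ _ ne (λ { (inj₁ (() , _)) ; (inj₂ (() , _)) })
edgeSpecial-shape χ d c e01 e10 h (suc (suc i)) (suc zero) ne = h _ _ ne (λ { (inj₁ (() , _)) ; (inj₂ (() , _)) })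
edgeSpecial-shape χ d c e01 e10 h (suc (suc i)) (suc (suc j)) ne = h _ _ ne (λ { (inj₁ (() , _)) ; (inj₂ (() , _)) })

-- The implicit arguments of trans and sym are given, since inferring them makes Agda unfold w.
w-relabelled-twoApex : ∀ k (φ : EdgeColoring (suc (suc (suc k)))) → Symmetric φ → RedBlue φ →
  (σ : Relabelling (suc (suc (suc k)))) (c e : Color) (r s : Fin (suc k) → Color) →
  IsTwoApex (relabel σ φ) c e r s → w φ ≡ TwoApex.wApex c e r s
w-relabelled-twoApex k φ sy rb σ c e r s shape =
  trans {i = w φ} {j = w (relabel σ φ)} {k = TwoApex.wApex c e r s}
    (sym {x = w (relabel σ φ)} {y = w φ} (w-relabel σ φ sy rb))
    (w≡wApex (relabel σ φ) (relabel-symmetric σ φ sy) (relabel-redBlue σ φ rb) c e r s shape)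

-- A special colouring, relabelled to put the special vertex or edge at the apexes, is a
-- two-apex colouring with monochromatic base.
w-vertexSpecial : ∀ k (φ : EdgeColoring (suc (suc (suc k)))) → Symmetric φ → RedBlue φ →
  VertexSpecial φ → w φ ≡ 3 * 2 ^ suc (suc k) + 1
w-vertexSpecial k φ sy rb (_ , v , c₁ , c₂ , c₁≢c₂ , hv , hr) =
  trans (w-relabelled-twoApex k φ sy rb σ c₂ (opp c₂) (λ _ → opp c₂) (λ _ → c₂)
           (vertexSpecial-shape (relabel σ φ) (opp c₂) c₂ row col rest))
        (wApex-vertexSpecial k rc₂)
  where
  σ : Relabelling (suc (suc (suc k)))
  σ = sending₀ v
  ≢v : ∀ {i} → i ≢ zero → to σ i ≢ v
  ≢v i≢0 e = i≢0 (to-injective σ (trans e (sym (sending₀-zero v))))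
  rc₁ : IsRB c₁
  rc₁ = isRB-at φ rb v (to σ (suc zero)) (≢v (λ ()) ∘ sym) (hv _ (≢v (λ ()) ∘ sym))
  rc₂ : IsRB c₂
  rc₂ = isRB-at φ rb (to σ (suc zero)) (to σ (suc (suc zero))) ((λ ()) ∘ to-injective σ)
          (hr _ _ ((λ ()) ∘ to-injective σ) (≢v (λ ())) (≢v (λ ())))
  c₁≡opp : c₁ ≡ opp c₂
  c₁≡opp with sameOrOpp-RB rc₂ rc₁
  ... | inj₁ e = ⊥-elim (c₁≢c₂ e)
  ... | inj₂ e = e
  row : ∀ j → zero ≢ j → (relabel σ φ) zero j ≡ opp c₂
  row j 0≢j = trans (cong (λ z → φ z (to σ j)) (sending₀-zero v)) (trans (hv _ (≢v (0≢j ∘ sym) ∘ sym)) c₁≡opp)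
  col : ∀ i → i ≢ zero → (relabel σ φ) i zero ≡ opp c₂
  col i i≢0 = trans (sy _ _ (i≢0 ∘ to-injective σ)) (row i (i≢0 ∘ sym))
  rest : ∀ i j → i ≢ j → i ≢ zero → j ≢ zero → (relabel σ φ) i j ≡ c₂
  rest i j i≢j i≢0 j≢0 = hr _ _ (i≢j ∘ to-injective σ) (≢v i≢0) (≢v j≢0)
w-edgeSpecial : ∀ k (φ : EdgeColoring (suc (suc (suc k)))) → Symmetric φ → RedBlue φ →
  EdgeSpecial φ → w φ ≡ 3 * 2 ^ suc (suc k) + 1
w-edgeSpecial k φ sy rb (_ , a , b , c , a≢b , φab≢c , h) = viaPair (sending₀₁ a b a≢b)
  where
  viaPair : Σ (Relabelling (suc (suc (suc k)))) (λ σ → (to σ zero ≡ a) × (to σ (suc zero) ≡ b)) →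
    w φ ≡ 3 * 2 ^ suc (suc k) + 1
  viaPair (σ , σ₀ , σ₁) =
    trans (w-relabelled-twoApex k φ sy rb σ c (opp c) (λ _ → c) (λ _ → c)
             (edgeSpecial-shape (relabel σ φ) (opp c) c e₀₁ e₁₀ rest))
          (wApex-edgeSpecial k rc)
    where
    rest : ∀ i j → i ≢ j → ¬ ((i ≡ zero × j ≡ suc zero) ⊎ (i ≡ suc zero × j ≡ zero)) → (relabel σ φ) i j ≡ c
    rest i j i≢j not01 = h _ _ (i≢j ∘ to-injective σ) λ
      { (inj₁ (x , y)) → not01 (inj₁ (to-injective σ (trans x (sym σ₀)) , to-injective σ (trans y (sym σ₁))))
      ; (inj₂ (x , y)) → not01 (inj₂ (to-injective σ (trans x (sym σ₁)) , to-injective σ (trans y (sym σ₀)))) }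
    rc : IsRB c
    rc = isRB-at (relabel σ φ) (relabel-redBlue σ φ rb) zero (suc (suc zero)) (λ ())
           (rest _ _ (λ ()) (λ { (inj₁ (_ , ())) ; (inj₂ (() , _)) }))
    φab≡opp : φ a b ≡ opp c
    φab≡opp with sameOrOpp-RB rc (isRB-at φ rb a b a≢b refl)
    ... | inj₁ e = ⊥-elim (φab≢c e)
    ... | inj₂ e = e
    e₀₁ : (relabel σ φ) zero (suc zero) ≡ opp c
    e₀₁ = trans (cong₂ φ σ₀ σ₁) φab≡opp
    e₁₀ : (relabel σ φ) (suc zero) zero ≡ opp c
    e₁₀ = trans (relabel-symmetric σ φ sy _ _ (λ ())) e₀₁

w-special : ∀ k (φ : EdgeColoring (suc (suc (suc k)))) → Symmetric φ → RedBlue φ →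
  Special φ → w φ ≡ 3 * 2 ^ suc (suc k) + 1
w-special k φ sy rb (inj₁ vs) = w-vertexSpecial k φ sy rb vs
w-special k φ sy rb (inj₂ es) = w-edgeSpecial k φ sy rb es

lemma2p5 : (n : ℕ) → 3 ≤ n → (φ : EdgeColoring n) → Symmetric φ → RedBlue φ →
    NonMonochromatic φ →
    (Special φ → w φ ≡ 3 * 2 ^ (n ∸ 1) + 1) × (¬ Special φ → w φ < 3 * 2 ^ (n ∸ 1))
lemma2p5 (suc (suc (suc k))) (s≤s (s≤s (s≤s _))) φ sy rb nm =
  w-special k φ sy rb , w<-nonSpecial k φ sy rb nm
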